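{- Let $t\ge 0$ be an integer with $q=4t+5$ a prime power, $s=t+1$, $F_q$ the field with $q$ elements, $C$ its set of nonzero squares, $V=F_q\times F_q$ and $X=\mathbb{P}(V)$ the projective line ($|X|=q+1$). For a basis $(u,v)$ of $V$, let $X^u=X\setminus\{\langle u\rangle\}$ and let $\Gamma^u_v$ be the graph on $X^u$ in which $\langle\alpha u+v\rangle$ and $\langle\beta u+v\rangle$ ($\alpha,\beta\in F_q$) are adjacent iff $\alpha-\beta\in C$. Fix a basis $(u,v)$ of $V$. 1. $\Gamma^u_v$ has diameter $2$, and for $x,y\in X^u$ (with $\Gamma=\Gamma^u_v$ and $\Gamma(z,1)$ the neighbourhood of $z$): if $x=y$ then $|\Gamma(x,1)|=(q-1)/2=2s$; if $x,y$ are adjacent then $|\Gamma(x,1)\cap\Gamma(y,1)|=t=s-1$; if $x,y$ are at distance $2$ then $|\Gamma(x,1)\cap\Gamma(y,1)|=s$. 2. Viewing $\Gamma^u_v$ as a graph on $X$ in which $\langle u\rangle$ is isolated, its localized graph at $\langle v\rangle$ is $\Gamma^v_u$ (viewed as a graph on $X$ in which $\langle v\rangle$ is isolated). 3.a. For every $\varphi\in GL_2(F_q)=GL(V)$, acting on $X$ by $\varphi(\langle w\rangle)=\langle\varphi(w)\rangle$, the image of $\Gamma^u_v$ under $\varphi$ is $\Gamma^{\varphi(u)}_{\varphi(v)}$. 3.b. If moreover $\varphi$ stabilizes the line $\langle u\rangle$, then $\Gamma^{\varphi(u)}_{\varphi(v)}=\Gamma^u_v$ when $\det\varphi$ is a square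 in $F_q$, and otherwise $\Gamma^{\varphi(u)}_{\varphi(v)}$ is the complement of $\Gamma^u_v$ on $X^u$. 4. The group $SL_2(V)$ has exactly two orbits on the set of all graphs $\Gamma^{u'}_{v'}$ ($(u',v')$ ranging over bases of $V$); the orbit of any one of them (viewed as a graph on $X$ with $\langle u'\rangle$ isolated) is the set of its localized graphs at all points of $X$.
   Context: For a simple graph $\Gamma$ on a finite set $X$, its matrix is $\mathcal{E}=(\varepsilon_{i,j})$ with $\varepsilon_{i,j}=-1$ if $i\ne j$ are adjacent and $1$ otherwise. Two graphs on $X$ with matrices $\mathcal{E},\mathcal{E}'$ are associated if there exist $\nu_i\in\{ -1,1\}$ with $\varepsilon'_{i,j}=\nu_i\nu_j\varepsilon_{i,j}$ for all $i,j$. For $x\in X$, the localized graph of $\Gamma$ at $x$ is the unique graph associated to $\Gamma$ in which $x$ is an isolated vertex. -}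

module Defs where

open import Data.Nat as ℕ using (ℕ; suc)
open import Data.Nat.Primality using (Prime)
open import Data.Fin using (Fin)
open import Data.Product using (Σ; _×_; _,_; proj₁; proj₂)
open import Data.Sum using (_⊎_)
open import Data.Sign as Sign using (Sign)
open import Relation.Nullary using (¬_)
open import Relation.Binary.PropositionalEquality using (_≡_; _≢_)
open import Algebra.Structures using (IsCommutativeRing)
open import Function.Bundles using (_↔_)

IsPrimePower : ℕ → Set
IsPrimePower q = Σ ℕ λ p → Σ ℕ λ k → Prime p × q ≡ p ℕ.^ suc k

record FiniteField (q : ℕ) : Set₁ where
  infixl 6 _+_
  infixl 7 _*_
  field
    F       : Set
    _+_ _*_ : F → F → F
    -_      : F → F
    0# 1#   : F
    isCommutativeRing : IsCommutativeRing _≡_ _+_ _*_ -_ 0# 1#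
    0≢1     : 0# ≢ 1#
    inverse : ∀ x → x ≢ 0# → Σ F λ y → x * y ≡ 1#
    card    : F ↔ Fin q

module FieldDefs {q : ℕ} (K : FiniteField q) where
  open FiniteField K public

  infixl 6 _-_
  _-_ : F → F → F
  x - y = x + (- y)

  IsSquare : F → Set
  IsSquare a = Σ F λ c → a ≡ c * c

  InC : F → Set
  InC a = a ≢ 0# × IsSquare a

  V : Set
  V = F × F

  0V : V
  0V = (0# , 0#)

  infixl 6 _⊕_
  _⊕_ : V → V → V
  (a , b) ⊕ (c , d) = (a + c , b + d)

  infixr 7 _·_
  _·_ : F → V → V
  c · (a , b) = (c * a , c * b)

  det : V → V → F
  det (a , b) (c , d) = a * d - b * c

  Basis : V → V → Set
  Basis u v = det u v ≢ 0#

  -- Points of X = P(V): nonzero vectors, identified up to nonzero scalars (setoid)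
  Point : Set
  Point = Σ V λ w → w ≢ 0V

  vec : Point → V
  vec = proj₁

  infix 4 _≈_
  _≈_ : Point → Point → Set
  x ≈ y = Σ F λ c → c ≢ 0# × vec y ≡ c · vec x

  LineOf : V → Point → Set
  LineOf w x = Σ F λ c → c ≢ 0# × vec x ≡ c · w

  Graph : Set₁
  Graph = Point → Point → Set

  IsGraph : Graph → Set
  IsGraph H = (∀ x y → H x y → H y x)
            × (∀ x → ¬ H x x)
            × (∀ x x′ y y′ → x ≈ x′ → y ≈ y′ → H x y → H x′ y′)

  infix 4 _≡G_
  _≡G_ : Graph → Graph → Set
  G ≡G H = ∀ x y → (G x y → H x y) × (H x y → G x y)

  Xu : V → Point → Set
  Xu u x = ¬ LineOf u x

  Γ : V → V → Graph
  Γ u v x y = Σ F λ α → Σ F λ β →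
    LineOf (α · u ⊕ v) x × LineOf (β · u ⊕ v) y × InC (α - β)

  Complement : (Point → Set) → Graph → Graph
  Complement Vert G x y = Vert x × Vert y × ¬ (x ≈ y) × ¬ G x y

  HasSize : (Point → Set) → ℕ → Set
  HasSize P n = Σ (Fin n → Point) λ f →
      (∀ i → P (f i))
    × (∀ i j → f i ≈ f j → i ≡ j)
    × (∀ x → P x → Σ (Fin n) λ i → x ≈ f i)

  data Walk (G : Graph) : Point → Point → ℕ → Set where
    here : ∀ {x y} → x ≈ y → Walk G x y 0
    step : ∀ {x z y n} → G x z → Walk G z y n → Walk G x y (suc n)

  Dist : Graph → Point → Point → ℕ → Set
  Dist G x y d = Walk G x y d × (∀ m → m ℕ.< d → ¬ Walk G x y m)

  Diameter : Graph → (Point → Set) → ℕ → Set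
  Diameter G Vert d =
      (∀ x y → Vert x → Vert y → Σ ℕ λ e → e ℕ.≤ d × Dist G x y e)
    × (Σ Point λ x → Σ Point λ y → Vert x × Vert y × Dist G x y d)

  -- the matrix ε of a graph: Eps G i j σ means ε_{i,j} = σ
  Eps : Graph → Point → Point → Sign → Set
  Eps G i j σ = (σ ≡ Sign.- × (¬ (i ≈ j) × G i j))
              ⊎ (σ ≡ Sign.+ × ¬ (¬ (i ≈ j) × G i j))

  -- associated graphs (switching by ν : X → {±1})
  Associated : Graph → Graph → Set
  Associated G H = Σ (Point → Sign) λ ν →
      (∀ i j → i ≈ j → ν i ≡ ν j)
    × (∀ i j σ → Eps G i j σ → Eps H i j (ν i Sign.* ν j Sign.* σ))

  Isolated : Graph → Point → Set
  Isolated H x = ∀ y → ¬ H x y × ¬ H y x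

  IsLocalization : Graph → Point → Graph → Set
  IsLocalization G x H = Associated G H × Isolated H x

  Mat : Set
  Mat = F × F × F × F

  app : Mat → V → V
  app (a , b , c , d) (w₁ , w₂) = (a * w₁ + b * w₂ , c * w₁ + d * w₂)

  detM : Mat → F
  detM (a , b , c , d) = a * d - b * c

  Img : Mat → Graph → Graph
  Img φ G x y = Σ Point λ x′ → Σ Point λ y′ →
    G x′ y′ × LineOf (app φ (vec x′)) x × LineOf (app φ (vec y′)) y

  Stabilizes : Mat → V → Set
  Stabilizes φ u = Σ F λ c → c ≢ 0# × app φ u ≡ c · u

  SameOrbit : Graph → Graph → Set
  SameOrbit G H = Σ Mat λ φ → detM φ ≡ 1# × H ≡G Img φ G

-- Adjacency in Γ^u_v is governed by the form Q(x,y) = det(u,v) det(x,y) det(u,x) det(u,y): on the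
-- chart α ↦ ⟨αu + v⟩ it is (α - β) times a nonzero square, so x ~ y iff Q(x,y) is a nonzero square.
-- Part 1 is then the strong regularity of the Paley graph of F_q, which comes down to counting:
-- |C| = |N| = 2s, -1 ∈ C, and the cyclotomic numbers #{z ∈ C | z - 1 ∈ C} = t, #{z ∈ N | z - 1 ∈ N} = s.
-- Part 3 holds because φ transports charts, and a φ fixing ⟨u⟩ multiplies Q by det φ times a square.
-- For parts 2 and 4, Q_{u′,v′}(x,y) Q_{u,v}(x,y) is det(u,v) det(u′,v′) times a square times a factor
-- depending on x and one depending on y; so when det(u,v) det(u′,v′) ∈ C, Γ^{u′}_{v′} is a switching of
-- Γ^u_v isolating ⟨u′⟩. Localizations being unique, the SL₂-orbit of Γ^u_v is the set of Γ^{u′}_{v′}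
-- with det(u,v) det(u′,v′) ∈ C, and there are two of them.

module Submission where

open import Defs
open import Data.Nat as ℕ using (ℕ; zero; suc; _≤_; z≤n; s≤s)
import Data.Nat.Properties as ℕ
open import Data.Nat.Tactic.RingSolver using (solve-∀)
open import Data.Integer as ℤ using (ℤ; -[1+_]; _⊖_)
import Data.Integer.Properties as ℤ
open import Data.Sign as Sign using (Sign; opposite)
import Data.Sign.Properties as Sign
open import Data.Maybe using (Maybe; just; nothing)
open import Data.Bool using (Bool; true; false; if_then_else_; not; _∧_)
open import Data.Bool.Properties using (∧-assoc; ∧-comm; ∧-zeroʳ; ∧-identityʳ)
open import Data.Fin as Fin using (Fin; zero; suc; toℕ)
import Data.Fin.Properties as Fin
open import Data.List using (List; []; _∷_; length; map; lookup; tabulate)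
open import Data.List.Properties using (length-map; length-tabulate)
open import Data.List.Membership.Propositional using (_∈_)
open import Data.List.Membership.Propositional.Properties using (∈-lookup; ∈-map⁻; ∈-tabulate⁺; ∈-tabulate⁻)
open import Data.List.Relation.Unary.Any using (here; there)
open import Data.Product using (Σ; _×_; _,_; proj₁; proj₂)
open import Data.Sum using (_⊎_; inj₁; inj₂; [_,_]′)
open import Data.Empty using (⊥-elim)
open import Relation.Nullary using (¬_; yes; no; Dec; does)
open import Relation.Binary.Definitions using (DecidableEquality)
open import Relation.Binary.PropositionalEquality
open import Function.Bundles using (Inverse)
open import Algebra.Bundles using (CommutativeRing; RawRing)
open import Algebra.Structures using (IsCommutativeRing)
open import Algebra.Solver.Ring.AlmostCommutativeRing
  using (fromCommutativeRing; _-Raw-AlmostCommutative⟶_)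
import Algebra.Properties.Ring as RingProperties
import Algebra.Properties.Semiring.Mult.TCOptimised as SemiringMultiples

-- Coefficients are integers, not ring elements, so that normal forms are compared by computation:
-- equality in an abstract finite field does not reduce.
module IntegerCoefficientSolver
  {A : Set} {add mul : A → A → A} {neg : A → A} {zeroᴬ oneᴬ : A}
  (isCommutativeRing : IsCommutativeRing _≡_ add mul neg zeroᴬ oneᴬ) where

  commutativeRing : CommutativeRing _ _
  commutativeRing = record { isCommutativeRing = isCommutativeRing }

  open CommutativeRing commutativeRing using (_+_; _*_; -_; 0#; 1#; ring; semiring; +-assoc; +-comm; +-identityˡ; +-identityʳ; -‿inverseʳ)
  open RingProperties ring using (-‿distribˡ-*; -‿distribʳ-*; -‿involutive; -0#≈0#; -‿+-comm)
  open SemiringMultiples semiring using (1+×; ×-homo-+; ×1-homo-*) renaming (_×_ to _×ᴬ_)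
  open ≡-Reasoning

  fromℤ : ℤ → A
  fromℤ (ℤ.+ n) = n ×ᴬ 1#
  fromℤ (-[1+ n ]) = - (suc n ×ᴬ 1#)

  signed : Sign → A → A
  signed Sign.+ x = x
  signed Sign.- x = - x

  signed-* : ∀ s s′ x y → signed (s Sign.* s′) (x * y) ≡ signed s x * signed s′ y
  signed-* Sign.+ Sign.+ x y = refl
  signed-* Sign.+ Sign.- x y = -‿distribʳ-* x y
  signed-* Sign.- Sign.+ x y = -‿distribˡ-* x y
  signed-* Sign.- Sign.- x y = begin
    x * y            ≡⟨ -‿involutive (x * y) ⟨
    - - (x * y)      ≡⟨ cong -_ (-‿distribʳ-* x y) ⟩
    - (x * - y)      ≡⟨ -‿distribˡ-* x (- y) ⟩
    - x * - y        ∎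

  fromℤ-◃ : ∀ s n → fromℤ (s ℤ.◃ n) ≡ signed s (n ×ᴬ 1#)
  fromℤ-◃ Sign.- zero = sym -0#≈0#
  fromℤ-◃ Sign.+ zero = refl
  fromℤ-◃ Sign.- (suc n) = refl
  fromℤ-◃ Sign.+ (suc n) = refl

  fromℤ-signAbs : ∀ i → fromℤ i ≡ signed (ℤ.sign i) (ℤ.∣ i ∣ ×ᴬ 1#)
  fromℤ-signAbs (ℤ.+ n) = refl
  fromℤ-signAbs -[1+ n ] = refl

  *-homo : ∀ i j → fromℤ (i ℤ.* j) ≡ fromℤ i * fromℤ j
  *-homo i j = begin
    fromℤ (s ℤ.◃ (ℤ.∣ i ∣ ℕ.* ℤ.∣ j ∣))                   ≡⟨ fromℤ-◃ s (ℤ.∣ i ∣ ℕ.* ℤ.∣ j ∣) ⟩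
    signed s ((ℤ.∣ i ∣ ℕ.* ℤ.∣ j ∣) ×ᴬ 1#)               ≡⟨ cong (signed s) (×1-homo-* ℤ.∣ i ∣ ℤ.∣ j ∣) ⟩
    signed s ((ℤ.∣ i ∣ ×ᴬ 1#) * (ℤ.∣ j ∣ ×ᴬ 1#))          ≡⟨ signed-* (ℤ.sign i) (ℤ.sign j) _ _ ⟩
    signed (ℤ.sign i) (ℤ.∣ i ∣ ×ᴬ 1#) * signed (ℤ.sign j) (ℤ.∣ j ∣ ×ᴬ 1#) ≡⟨ cong₂ _*_ (fromℤ-signAbs i) (fromℤ-signAbs j) ⟨
    fromℤ i * fromℤ j                                      ∎
    where s = ℤ.sign i Sign.* ℤ.sign j

  fromℤ-⊖ : ∀ m n → fromℤ (m ⊖ n) ≡ m ×ᴬ 1# + - (n ×ᴬ 1#)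
  fromℤ-⊖ zero zero = sym (trans (cong (0# +_) -0#≈0#) (+-identityˡ 0#))
  fromℤ-⊖ (suc m) zero = sym (trans (cong (suc m ×ᴬ 1# +_) -0#≈0#) (+-identityʳ _))
  fromℤ-⊖ zero (suc n) = sym (+-identityˡ _)
  fromℤ-⊖ (suc m) (suc n) = begin
    fromℤ (suc m ⊖ suc n)              ≡⟨ cong fromℤ (ℤ.[1+m]⊖[1+n]≡m⊖n m n) ⟩
    fromℤ (m ⊖ n)                      ≡⟨ fromℤ-⊖ m n ⟩
    a + - b                            ≡⟨ cong (a +_) (+-identityˡ (- b)) ⟨
    a + (0# + - b)                     ≡⟨ cong (λ z → a + (z + - b)) (-‿inverseʳ 1#) ⟨
    a + ((1# + - 1#) + - b)            ≡⟨ cong (a +_) (+-assoc 1# (- 1#) (- b)) ⟩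
    a + (1# + (- 1# + - b))            ≡⟨ +-assoc a 1# _ ⟨
    (a + 1#) + (- 1# + - b)            ≡⟨ cong₂ _+_ (+-comm a 1#) (-‿+-comm 1# b) ⟩
    (1# + a) + - (1# + b)              ≡⟨ cong₂ (λ x y → x + - y) (1+× m 1#) (1+× n 1#) ⟨
    suc m ×ᴬ 1# + - (suc n ×ᴬ 1#)      ∎
    where a = m ×ᴬ 1#
          b = n ×ᴬ 1#

  +-homo : ∀ i j → fromℤ (i ℤ.+ j) ≡ fromℤ i + fromℤ j
  +-homo (ℤ.+ m) (ℤ.+ n) = ×-homo-+ 1# m n
  +-homo (ℤ.+ m) -[1+ n ] = fromℤ-⊖ m (suc n)
  +-homo -[1+ m ] (ℤ.+ n) = trans (fromℤ-⊖ n (suc m)) (+-comm _ _)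
  +-homo -[1+ m ] -[1+ n ] = begin
    - (suc (suc (m ℕ.+ n)) ×ᴬ 1#)        ≡⟨ cong (λ k → - (suc k ×ᴬ 1#)) (ℕ.+-suc m n) ⟨
    - ((suc m ℕ.+ suc n) ×ᴬ 1#)          ≡⟨ cong -_ (×-homo-+ 1# (suc m) (suc n)) ⟩
    - (suc m ×ᴬ 1# + suc n ×ᴬ 1#)         ≡⟨ -‿+-comm _ _ ⟨
    - (suc m ×ᴬ 1#) + - (suc n ×ᴬ 1#)     ∎

  -‿homo : ∀ i → fromℤ (ℤ.- i) ≡ - fromℤ i
  -‿homo (ℤ.+ zero) = sym -0#≈0#
  -‿homo (ℤ.+ suc n) = refl
  -‿homo -[1+ n ] = sym (-‿involutive _)

  ℤ-rawRing : RawRing _ _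
  ℤ-rawRing = record
    { Carrier = ℤ ; _≈_ = _≡_ ; _+_ = ℤ._+_ ; _*_ = ℤ._*_ ; -_ = ℤ.-_ ; 0# = ℤ.+ 0 ; 1# = ℤ.+ 1 }

  ℤ⟶A : ℤ-rawRing -Raw-AlmostCommutative⟶ fromCommutativeRing commutativeRing
  ℤ⟶A = record
    { ⟦_⟧ = fromℤ ; +-homo = +-homo ; *-homo = *-homo ; -‿homo = -‿homo
    ; 0-homo = refl ; 1-homo = refl }

  fromℤ-≟ : ∀ i j → Maybe (fromℤ i ≡ fromℤ j)
  fromℤ-≟ i j with i ℤ.≟ j
  ... | yes refl = just refl
  ... | no _ = nothing

  open import Algebra.Solver.Ring ℤ-rawRing (fromCommutativeRing commutativeRing) ℤ⟶A fromℤ-≟ public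

  :0 :1 : ∀ {n} → Polynomial n
  :0 = con (ℤ.+ 0)
  :1 = con (ℤ.+ 1)

∧-true⇒ : ∀ {a b} → (a ∧ b) ≡ true → a ≡ true × b ≡ true
∧-true⇒ {true} {true} _ = refl , refl

⇒∧-true : ∀ {a b} → a ≡ true → b ≡ true → (a ∧ b) ≡ true
⇒∧-true refl refl = refl

true≢false : true ≢ false
true≢false ()

module ListCounting {A : Set} (_≟_ : DecidableEquality A) where

  data Nodup : List A → Set where
    []  : Nodup []
    _∷_ : ∀ {x xs} → ¬ x ∈ xs → Nodup xs → Nodup (x ∷ xs)

  select : (A → Bool) → List A → List A
  select p [] = []
  select p (x ∷ xs) = if p x then x ∷ select p xs else select p xs

  count : (A → Bool) → List A → ℕ
  count p xs = length (select p xs)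

  select-∈ : ∀ (p : A → Bool) xs {y} → y ∈ select p xs → y ∈ xs × p y ≡ true
  select-∈ p (x ∷ xs) m with p x in px
  select-∈ p (x ∷ xs) (here refl) | true = here refl , px
  select-∈ p (x ∷ xs) (there m) | true = let (m′ , py) = select-∈ p xs m in there m′ , py
  ... | false = let (m′ , py) = select-∈ p xs m in there m′ , py

  ∈-select : ∀ (p : A → Bool) xs {y} → y ∈ xs → p y ≡ true → y ∈ select p xs
  ∈-select p (x ∷ xs) (here refl) py rewrite py = here refl
  ∈-select p (x ∷ xs) (there m) py with p x
  ... | true = there (∈-select p xs m py)
  ... | false = ∈-select p xs m py

  select-nodup : ∀ (p : A → Bool) {xs} → Nodup xs → Nodup (select p xs)
  select-nodup p [] = []
  select-nodup p {x ∷ xs} (x∉ ∷ nd) with p x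
  ... | true = (λ m → x∉ (proj₁ (select-∈ p xs m))) ∷ select-nodup p nd
  ... | false = select-nodup p nd

  remove : A → List A → List A
  remove x [] = []
  remove x (y ∷ ys) with y ≟ x
  ... | yes _ = remove x ys
  ... | no _ = y ∷ remove x ys

  length-remove≤ : ∀ x ys → length (remove x ys) ≤ length ys
  length-remove≤ x [] = z≤n
  length-remove≤ x (y ∷ ys) with y ≟ x
  ... | yes _ = ℕ.m≤n⇒m≤1+n (length-remove≤ x ys)
  ... | no _ = s≤s (length-remove≤ x ys)

  length-remove< : ∀ x ys → x ∈ ys → suc (length (remove x ys)) ≤ length ys
  length-remove< x (y ∷ ys) m with y ≟ x
  length-remove< x (y ∷ ys) m | yes refl = s≤s (length-remove≤ x ys)
  length-remove< x (y ∷ ys) (here refl) | no x≢x = ⊥-elim (x≢x refl)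
  length-remove< x (y ∷ ys) (there m) | no _ = s≤s (length-remove< x ys m)

  ∈-remove : ∀ x ys {y} → y ∈ ys → y ≢ x → y ∈ remove x ys
  ∈-remove x (z ∷ zs) m y≢x with z ≟ x
  ∈-remove x (z ∷ zs) (here refl) y≢x | yes z≡x = ⊥-elim (y≢x z≡x)
  ∈-remove x (z ∷ zs) (there m) y≢x | yes _ = ∈-remove x zs m y≢x
  ∈-remove x (z ∷ zs) (here refl) y≢x | no _ = here refl
  ∈-remove x (z ∷ zs) (there m) y≢x | no _ = there (∈-remove x zs m y≢x)

  nodup-length≤ : ∀ {xs} ys → Nodup xs → (∀ {y} → y ∈ xs → y ∈ ys) → length xs ≤ length ys
  nodup-length≤ ys [] _ = z≤n
  nodup-length≤ {x ∷ xs} ys (x∉ ∷ nd) xs⊆ys = ℕ.≤-trans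
    (s≤s (nodup-length≤ (remove x ys) nd (λ m → ∈-remove x ys (xs⊆ys (there m)) (λ { refl → x∉ m }))))
    (length-remove< x ys (xs⊆ys (here refl)))

  map-nodup : ∀ (f : A → A) {xs} → Nodup xs → (∀ {a b} → a ∈ xs → b ∈ xs → f a ≡ f b → a ≡ b) → Nodup (map f xs)
  map-nodup f [] _ = []
  map-nodup f {x ∷ xs} (x∉ ∷ nd) f-inj =
    (λ m → let (b , b∈ , fx≡fb) = ∈-map⁻ f m in x∉ (subst (_∈ xs) (sym (f-inj (here refl) (there b∈) fx≡fb)) b∈))
    ∷ map-nodup f nd (λ a b → f-inj (there a) (there b))

  lookup-injective : ∀ {xs} → Nodup xs → ∀ i j → lookup xs i ≡ lookup xs j → i ≡ j
  lookup-injective (_ ∷ _) zero zero _ = refl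
  lookup-injective {x ∷ xs} (x∉ ∷ _) zero (suc j) e = ⊥-elim (x∉ (subst (_∈ xs) (sym e) (∈-lookup j)))
  lookup-injective {x ∷ xs} (x∉ ∷ _) (suc i) zero e = ⊥-elim (x∉ (subst (_∈ xs) e (∈-lookup i)))
  lookup-injective (_ ∷ nd) (suc i) (suc j) e = cong suc (lookup-injective nd i j e)

  index : ∀ {xs} {y : A} → y ∈ xs → Σ (Fin (length xs)) λ i → lookup xs i ≡ y
  index (here refl) = zero , refl
  index (there m) = let (i , e) = index m in suc i , e

  count-∧-split : ∀ (p r : A → Bool) xs → count p xs ≡ count (λ x → p x ∧ r x) xs ℕ.+ count (λ x → p x ∧ not (r x)) xs
  count-∧-split p r [] = refl
  count-∧-split p r (x ∷ xs) with p x | r x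
  ... | true | true = cong suc (count-∧-split p r xs)
  ... | true | false = trans (cong suc (count-∧-split p r xs)) (sym (ℕ.+-suc _ _))
  ... | false | _ = count-∧-split p r xs

  count-cong : ∀ (p r : A → Bool) xs → (∀ x → p x ≡ r x) → count p xs ≡ count r xs
  count-cong p r [] _ = refl
  count-cong p r (x ∷ xs) p≗r with p x | r x | p≗r x
  ... | true | true | _ = cong suc (count-cong p r xs p≗r)
  ... | false | false | _ = count-cong p r xs p≗r
  ... | true | false | ()
  ... | false | true | ()

  count≡0⇒ : ∀ (p : A → Bool) xs → count p xs ≡ 0 → ∀ {x} → x ∈ xs → p x ≡ false
  count≡0⇒ p (y ∷ ys) e m with p y in py
  count≡0⇒ p (y ∷ ys) e (here refl) | false = py
  count≡0⇒ p (y ∷ ys) e (there m) | false = count≡0⇒ p ys e m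

  ⇒count≡0 : ∀ (p : A → Bool) xs → (∀ {x} → x ∈ xs → p x ≡ false) → count p xs ≡ 0
  ⇒count≡0 p [] _ = refl
  ⇒count≡0 p (y ∷ ys) none with p y | none {y} (here refl)
  ... | false | _ = ⇒count≡0 p ys (λ m → none (there m))

  count≢0⇒ : ∀ (p : A → Bool) xs k → count p xs ≡ suc k → Σ A λ x → x ∈ xs × p x ≡ true
  count≢0⇒ p (y ∷ ys) k e with p y in py
  ... | true = y , here refl , py
  ... | false = let (x , m , px) = count≢0⇒ p ys k e in x , there m , px

  count-const-true : ∀ xs → count (λ _ → true) xs ≡ length xs
  count-const-true [] = refl
  count-const-true (x ∷ xs) = cong suc (count-const-true xs)

  count-singleton : ∀ (p : A → Bool) xs a → Nodup xs → a ∈ xs → (∀ x → p x ≡ true → x ≡ a) → p a ≡ true → count p xs ≡ 1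
  count-singleton p (y ∷ ys) a (y∉ ∷ nd) a∈ only pa with p y in py
  ... | true = cong suc (⇒count≡0 p ys λ {x} x∈ → p≡false x x∈)
    where
    p≡false : ∀ x → x ∈ ys → p x ≡ false
    p≡false x x∈ with p x in px
    ... | false = refl
    ... | true = ⊥-elim (y∉ (subst (_∈ ys) (trans (only x px) (sym (only y py))) x∈))
  count-singleton p (y ∷ ys) a (_ ∷ _) (here refl) only pa | false = ⊥-elim (false≢true (trans (sym py) pa))
    where false≢true : false ≢ true
          false≢true ()
  count-singleton p (y ∷ ys) a (_ ∷ nd) (there a∈) only pa | false = count-singleton p ys a nd a∈ only pa

  count-injection : ∀ (p r : A → Bool) xs → Nodup xs → (f : A → A) →
                    (∀ x → x ∈ xs → p x ≡ true → f x ∈ xs × r (f x) ≡ true) →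
                    (∀ x y → p x ≡ true → p y ≡ true → f x ≡ f y → x ≡ y) →
                    count p xs ≤ count r xs
  count-injection p r xs nd f maps f-inj =
    subst (_≤ count r xs) (length-map f (select p xs))
      (nodup-length≤ (select r xs)
        (map-nodup f (select-nodup p nd)
          (λ a b → f-inj _ _ (proj₂ (select-∈ p xs a)) (proj₂ (select-∈ p xs b))))
        (λ m → let (b , b∈ , e) = ∈-map⁻ f m
                   (b∈xs , pb) = select-∈ p xs b∈
                   (fb∈ , rfb) = maps b b∈xs pb
               in subst (_∈ select r xs) (sym e) (∈-select r xs fb∈ rfb)))

module FieldBasics {q : ℕ} (K : FiniteField q) where
  open FieldDefs K
  open IntegerCoefficientSolver isCommutativeRing public
  open CommutativeRing commutativeRing public
    using (+-assoc; +-comm; *-assoc; *-comm; +-identityˡ; +-identityʳ; *-identityˡ; *-identityʳ;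
           distribˡ; distribʳ; -‿inverseˡ; -‿inverseʳ; zeroˡ; zeroʳ)
  open RingProperties (CommutativeRing.ring commutativeRing) public
    using (-0#≈0#; -‿involutive; x∙y⁻¹≈ε⇒x≈y)
  open Inverse card using (to; from; strictlyInverseˡ; strictlyInverseʳ)
  open ≡-Reasoning

  to-injective : ∀ {x y} → to x ≡ to y → x ≡ y
  to-injective {x} {y} e = trans (sym (strictlyInverseʳ x)) (trans (cong from e) (strictlyInverseʳ y))

  infix 4 _≟_
  _≟_ : DecidableEquality F
  x ≟ y with to x Fin.≟ to y
  ... | yes e = yes (to-injective e)
  ... | no ne = no (λ e → ne (cong to e))

  open ListCounting _≟_ public

  elements : List F
  elements = tabulate from

  ∈-elements : ∀ x → x ∈ elements
  ∈-elements x = subst (_∈ elements) (strictlyInverseʳ x) (∈-tabulate⁺ (to x))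

  tabulate-nodup : ∀ {n} (f : Fin n → F) → (∀ i j → f i ≡ f j → i ≡ j) → Nodup (tabulate f)
  tabulate-nodup {zero} f _ = []
  tabulate-nodup {suc n} f f-inj =
    (λ m → let (i , e) = ∈-tabulate⁻ m in zero≢suc (f-inj zero (suc i) e))
    ∷ tabulate-nodup (λ i → f (suc i)) (λ i j e → Fin.suc-injective (f-inj (suc i) (suc j) e))
    where zero≢suc : ∀ {i : Fin n} → Fin.zero ≢ suc i
          zero≢suc ()

  elements-nodup : Nodup elements
  elements-nodup = tabulate-nodup from
    (λ i j e → trans (sym (strictlyInverseˡ i)) (trans (cong to e) (strictlyInverseˡ j)))

  # : (F → Bool) → ℕ
  # p = count p elements

  #-∧-split : ∀ p r → # p ≡ # (λ x → p x ∧ r x) ℕ.+ # (λ x → p x ∧ not (r x))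
  #-∧-split p r = count-∧-split p r elements

  #-cong : ∀ p r → (∀ x → p x ≡ r x) → # p ≡ # r
  #-cong p r = count-cong p r elements

  #≡0⇒ : ∀ p → # p ≡ 0 → ∀ x → p x ≡ false
  #≡0⇒ p e x = count≡0⇒ p elements e (∈-elements x)

  ⇒#≡0 : ∀ p → (∀ x → p x ≡ false) → # p ≡ 0
  ⇒#≡0 p none = ⇒count≡0 p elements (λ {x} _ → none x)

  #≢0⇒ : ∀ p k → # p ≡ suc k → Σ F λ x → p x ≡ true
  #≢0⇒ p k e = let (x , _ , px) = count≢0⇒ p elements k e in x , px

  #-true : # (λ _ → true) ≡ q
  #-true = trans (count-const-true elements) (length-tabulate from)

  #-singleton : ∀ p a → (∀ x → p x ≡ true → x ≡ a) → p a ≡ true → # p ≡ 1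
  #-singleton p a = count-singleton p elements a elements-nodup (∈-elements a)

  #-bijection : ∀ (p r : F → Bool) (f g : F → F) →
                (∀ x → p x ≡ true → r (f x) ≡ true) → (∀ y → r y ≡ true → p (g y) ≡ true) →
                (∀ x → p x ≡ true → g (f x) ≡ x) → (∀ y → r y ≡ true → f (g y) ≡ y) → # p ≡ # r
  #-bijection p r f g pf rg gf fg = ℕ.≤-antisym
    (count-injection p r elements elements-nodup f (λ x _ px → ∈-elements (f x) , pf x px)
      (λ x y px py e → trans (sym (gf x px)) (trans (cong g e) (gf y py))))
    (count-injection r p elements elements-nodup g (λ y _ ry → ∈-elements (g y) , rg y ry)
      (λ x y rx ry e → trans (sym (fg x rx)) (trans (cong f e) (fg y ry))))

  #-permutation : ∀ (p r : F → Bool) (f g : F → F) → (∀ x → g (f x) ≡ x) → (∀ y → f (g y) ≡ y) →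
                  (∀ x → p x ≡ r (f x)) → # p ≡ # r
  #-permutation p r f g gf fg p≡r∘f = #-bijection p r f g
    (λ x px → trans (sym (p≡r∘f x)) px) (λ y ry → trans (p≡r∘f (g y)) (trans (cong r (fg y)) ry))
    (λ x _ → gf x) (λ y _ → fg y)

  searchIn : (P : F → Set) → (∀ x → Dec (P x)) → ∀ xs → Dec (Σ F λ x → x ∈ xs × P x)
  searchIn P P? [] = no λ { (_ , () , _) }
  searchIn P P? (y ∷ ys) with P? y | searchIn P P? ys
  ... | yes py | _ = yes (y , here refl , py)
  ... | no _ | yes (x , x∈ , px) = yes (x , there x∈ , px)
  ... | no ¬py | no ¬found = no λ { (_ , here refl , py) → ¬py py ; (x , there x∈ , px) → ¬found (x , x∈ , px) }

  search : (P : F → Set) → (∀ x → Dec (P x)) → Dec (Σ F P)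
  search P P? with searchIn P P? elements
  ... | yes (x , _ , px) = yes (x , px)
  ... | no ¬found = no λ (x , px) → ¬found (x , ∈-elements x , px)

  -- An arbitrary strict total order on F, used to pick one element out of each orbit of an involution.
  infix 4 _≺_
  _≺_ : F → F → Bool
  x ≺ y = toℕ (to x) ℕ.<ᵇ toℕ (to y)

  ≺-asym : ∀ x y → (x ≺ y) ≡ true → (y ≺ x) ≡ false
  ≺-asym x y = asym (toℕ (to x)) (toℕ (to y))
    where asym : ∀ m n → (m ℕ.<ᵇ n) ≡ true → (n ℕ.<ᵇ m) ≡ false
          asym zero (suc n) _ = refl
          asym (suc m) (suc n) e = asym m n e

  ≺-connex : ∀ x y → x ≢ y → (x ≺ y) ≡ false → (y ≺ x) ≡ true
  ≺-connex x y x≢y = connex (toℕ (to x)) (toℕ (to y)) (λ e → x≢y (to-injective (Fin.toℕ-injective e)))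
    where
    connex : ∀ m n → m ≢ n → (m ℕ.<ᵇ n) ≡ false → (n ℕ.<ᵇ m) ≡ true
    connex zero zero m≢n _ = ⊥-elim (m≢n refl)
    connex (suc m) zero _ _ = refl
    connex (suc m) (suc n) m≢n e = connex m n (λ e′ → m≢n (cong suc e′)) e

  #-involution : ∀ (r : F → Bool) (f : F → F) → (∀ x → f (f x) ≡ x) → (∀ x → r x ≡ true → r (f x) ≡ true) →
                 (∀ x → r x ≡ true → f x ≢ x) →
                 # r ≡ # (λ x → r x ∧ (x ≺ f x)) ℕ.+ # (λ x → r x ∧ (x ≺ f x))
  #-involution r f f∘f r∘f f-nofix = trans (#-∧-split r (λ x → x ≺ f x))
    (cong (# (λ x → r x ∧ (x ≺ f x)) ℕ.+_) (sym (#-bijection _ _ f f forth back (λ x _ → f∘f x) (λ x _ → f∘f x))))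
    where
    forth : ∀ x → (r x ∧ (x ≺ f x)) ≡ true → (r (f x) ∧ not (f x ≺ f (f x))) ≡ true
    forth x e with r x in rx | x ≺ f x in lt
    ... | true | true rewrite r∘f x rx | f∘f x | ≺-asym x (f x) lt = refl
    back : ∀ x → (r x ∧ not (x ≺ f x)) ≡ true → (r (f x) ∧ (f x ≺ f (f x))) ≡ true
    back x e with r x in rx | x ≺ f x in lt
    ... | true | false rewrite r∘f x rx | f∘f x | ≺-connex x (f x) (λ e′ → f-nofix x rx (sym e′)) lt = refl

  inv : F → F
  inv x with x ≟ 0#
  ... | yes _ = 0#
  ... | no x≢0 = proj₁ (inverse x x≢0)

  *-inverseʳ : ∀ x → x ≢ 0# → x * inv x ≡ 1#
  *-inverseʳ x x≢0 with x ≟ 0#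
  ... | yes x≡0 = ⊥-elim (x≢0 x≡0)
  ... | no x≢0′ = proj₂ (inverse x x≢0′)

  *-inverseˡ : ∀ x → x ≢ 0# → inv x * x ≡ 1#
  *-inverseˡ x x≢0 = trans (*-comm _ _) (*-inverseʳ x x≢0)

  inv-0 : inv 0# ≡ 0#
  inv-0 with 0# ≟ 0#
  ... | yes _ = refl
  ... | no 0≢0 = ⊥-elim (0≢0 refl)

  1≢0 : 1# ≢ 0#
  1≢0 e = 0≢1 (sym e)

  *-cancelˡ : ∀ a x y → a ≢ 0# → a * x ≡ a * y → x ≡ y
  *-cancelˡ a x y a≢0 e = begin
    x                  ≡⟨ *-identityˡ x ⟨
    1# * x             ≡⟨ cong (_* x) (*-inverseˡ a a≢0) ⟨
    (inv a * a) * x    ≡⟨ *-assoc (inv a) a x ⟩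
    inv a * (a * x)    ≡⟨ cong (inv a *_) e ⟩
    inv a * (a * y)    ≡⟨ *-assoc (inv a) a y ⟨
    (inv a * a) * y    ≡⟨ cong (_* y) (*-inverseˡ a a≢0) ⟩
    1# * y             ≡⟨ *-identityˡ y ⟩
    y                  ∎

  zero-product : ∀ x y → x * y ≡ 0# → x ≡ 0# ⊎ y ≡ 0#
  zero-product x y e with x ≟ 0#
  ... | yes x≡0 = inj₁ x≡0
  ... | no x≢0 = inj₂ (*-cancelˡ x y 0# x≢0 (trans e (sym (zeroʳ x))))

  *-≢0 : ∀ {x y} → x ≢ 0# → y ≢ 0# → x * y ≢ 0#
  *-≢0 x≢0 y≢0 e with zero-product _ _ e
  ... | inj₁ x≡0 = x≢0 x≡0
  ... | inj₂ y≡0 = y≢0 y≡0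

  -‿≢0 : ∀ x → x ≢ 0# → - x ≢ 0#
  -‿≢0 x x≢0 e = x≢0 (trans (sym (-‿involutive x)) (trans (cong -_ e) -0#≈0#))

  inv-≢0 : ∀ x → x ≢ 0# → inv x ≢ 0#
  inv-≢0 x x≢0 e = 1≢0 (trans (sym (*-inverseʳ x x≢0)) (trans (cong (x *_) e) (zeroʳ x)))

  inv-involutive : ∀ x → inv (inv x) ≡ x
  inv-involutive x = by-cases (x ≟ 0#)
    where
    by-cases : Dec (x ≡ 0#) → inv (inv x) ≡ x
    by-cases (yes refl) = trans (cong inv inv-0) inv-0
    by-cases (no x≢0) = *-cancelˡ (inv x) (inv (inv x)) x (inv-≢0 x x≢0)
                          (trans (*-inverseʳ (inv x) (inv-≢0 x x≢0)) (sym (*-inverseˡ x x≢0)))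

  x-y≡0⇒x≡y : ∀ x y → x - y ≡ 0# → x ≡ y
  x-y≡0⇒x≡y = x∙y⁻¹≈ε⇒x≈y

  x*x≡y*y⇒x≡±y : ∀ x y → x * x ≡ y * y → x ≡ y ⊎ x ≡ - y
  x*x≡y*y⇒x≡±y x y e with zero-product (x - y) (x + y) (begin
      (x - y) * (x + y)   ≡⟨ solve 2 (λ x y → (x :- y) :* (x :+ y) := x :* x :- y :* y) refl x y ⟩
      x * x - y * y       ≡⟨ cong (_- y * y) e ⟩
      y * y - y * y       ≡⟨ -‿inverseʳ (y * y) ⟩
      0#                  ∎)
  ... | inj₁ x-y≡0 = inj₁ (x-y≡0⇒x≡y x y x-y≡0)
  ... | inj₂ x+y≡0 = inj₂ (x-y≡0⇒x≡y x (- y) (trans (cong (x +_) (-‿involutive y)) x+y≡0))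

  isSquare? : ∀ a → Dec (IsSquare a)
  isSquare? a = search (λ c → a ≡ c * c) (λ c → a ≟ c * c)

  isZero isSquare isResidue isNonResidue : F → Bool
  isZero x = does (x ≟ 0#)
  isSquare a = does (isSquare? a)
  isResidue a = not (isZero a) ∧ isSquare a
  isNonResidue a = not (isZero a) ∧ not (isSquare a)

  isZero⇒ : ∀ {x} → isZero x ≡ true → x ≡ 0#
  isZero⇒ {x} e with x ≟ 0#
  ... | yes x≡0 = x≡0

  ¬isZero⇒ : ∀ {x} → isZero x ≡ false → x ≢ 0#
  ¬isZero⇒ {x} e with x ≟ 0#
  ... | no x≢0 = x≢0

  ⇒isZero : ∀ {x} → x ≡ 0# → isZero x ≡ true
  ⇒isZero {x} x≡0 with x ≟ 0#
  ... | yes _ = refl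
  ... | no x≢0 = ⊥-elim (x≢0 x≡0)

  ⇒¬isZero : ∀ {x} → x ≢ 0# → isZero x ≡ false
  ⇒¬isZero {x} x≢0 with x ≟ 0#
  ... | yes x≡0 = ⊥-elim (x≢0 x≡0)
  ... | no _ = refl

  isSquare⇒ : ∀ {a} → isSquare a ≡ true → IsSquare a
  isSquare⇒ {a} e with isSquare? a
  ... | yes sq = sq

  ¬isSquare⇒ : ∀ {a} → isSquare a ≡ false → ¬ IsSquare a
  ¬isSquare⇒ {a} e with isSquare? a
  ... | no ¬sq = ¬sq

  ⇒isSquare : ∀ {a} → IsSquare a → isSquare a ≡ true
  ⇒isSquare {a} sq with isSquare? a
  ... | yes _ = refl
  ... | no ¬sq = ⊥-elim (¬sq sq)

  ⇒¬isSquare : ∀ {a} → ¬ IsSquare a → isSquare a ≡ false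
  ⇒¬isSquare {a} ¬sq with isSquare? a
  ... | yes sq = ⊥-elim (¬sq sq)
  ... | no _ = refl

  isResidue⇒ : ∀ {a} → isResidue a ≡ true → InC a
  isResidue⇒ {a} e with isZero a in z | isSquare a in sq
  ... | false | true = ¬isZero⇒ z , isSquare⇒ sq

  ⇒isResidue : ∀ {a} → InC a → isResidue a ≡ true
  ⇒isResidue (a≢0 , sq) rewrite ⇒¬isZero a≢0 | ⇒isSquare sq = refl

  ¬isResidue⇒ : ∀ {a} → isResidue a ≡ false → ¬ InC a
  ¬isResidue⇒ e c with trans (sym (⇒isResidue c)) e
  ... | ()

  ⇒¬isResidue : ∀ {a} → ¬ InC a → isResidue a ≡ false
  ⇒¬isResidue {a} ¬c with isResidue a in e
  ... | true = ⊥-elim (¬c (isResidue⇒ e))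
  ... | false = refl

  isNonResidue⇒ : ∀ {a} → isNonResidue a ≡ true → a ≢ 0# × ¬ IsSquare a
  isNonResidue⇒ {a} e with isZero a in z | isSquare a in sq
  ... | false | false = ¬isZero⇒ z , ¬isSquare⇒ sq

  ⇒isNonResidue : ∀ {a} → a ≢ 0# → ¬ IsSquare a → isNonResidue a ≡ true
  ⇒isNonResidue a≢0 ¬sq rewrite ⇒¬isZero a≢0 | ⇒¬isSquare ¬sq = refl

  sqrt : F → F
  sqrt a with isSquare? a
  ... | yes (c , _) = c
  ... | no _ = 0#

  sqrt-square : ∀ a → IsSquare a → sqrt a * sqrt a ≡ a
  sqrt-square a sq with isSquare? a
  ... | yes (c , a≡c²) = sym a≡c²
  ... | no ¬sq = ⊥-elim (¬sq sq)

  residue-*-square : ∀ a k → k ≢ 0# → InC a → InC (a * (k * k))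
  residue-*-square a k k≢0 (a≢0 , (c , a≡c²)) = *-≢0 a≢0 (*-≢0 k≢0 k≢0) ,
    (c * k , trans (cong (_* (k * k)) a≡c²) (solve 2 (λ c k → (c :* c) :* (k :* k) := (c :* k) :* (c :* k)) refl c k))

  residue-/-square : ∀ a k → k ≢ 0# → InC (a * (k * k)) → InC a
  residue-/-square a k k≢0 c = subst InC a·k²·k⁻²≡a (residue-*-square (a * (k * k)) (inv k) (inv-≢0 k k≢0) c)
    where
    a·k²·k⁻²≡a : a * (k * k) * (inv k * inv k) ≡ a
    a·k²·k⁻²≡a = begin
      a * (k * k) * (inv k * inv k)        ≡⟨ solve 3 (λ a k i → a :* (k :* k) :* (i :* i) := a :* ((k :* i) :* (k :* i))) refl a k (inv k) ⟩
      a * ((k * inv k) * (k * inv k))      ≡⟨ cong (λ z → a * (z * z)) (*-inverseʳ k k≢0) ⟩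
      a * (1# * 1#)                        ≡⟨ solve 1 (λ a → a :* (:1 :* :1) := a) refl a ⟩
      a                                    ∎

  isResidue-*-square : ∀ a k → k ≢ 0# → isResidue (a * (k * k)) ≡ isResidue a
  isResidue-*-square a k k≢0 with isResidue a in e
  ... | true = ⇒isResidue (residue-*-square a k k≢0 (isResidue⇒ e))
  ... | false = ⇒¬isResidue (λ c → ¬isResidue⇒ e (residue-/-square a k k≢0 c))

odd≢even : ∀ m n → suc (m ℕ.+ m) ≢ n ℕ.+ n
odd≢even m zero ()
odd≢even zero (suc n) e with trans (ℕ.suc-injective e) (ℕ.+-suc n n)
... | ()
odd≢even (suc m) (suc n) e = odd≢even m n
  (ℕ.suc-injective (trans (cong suc (sym (ℕ.+-suc m m))) (trans (ℕ.suc-injective e) (ℕ.+-suc n n))))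

double-injective : ∀ m n → m ℕ.+ m ≡ n ℕ.+ n → m ≡ n
double-injective zero zero _ = refl
double-injective (suc m) (suc n) e = cong suc (double-injective m n
  (ℕ.suc-injective (trans (sym (ℕ.+-suc m m)) (trans (ℕ.suc-injective e) (ℕ.+-suc n n)))))

q≡1+2s+2s : ∀ t → 4 ℕ.* t ℕ.+ 5 ≡ suc (2 ℕ.* suc t ℕ.+ 2 ℕ.* suc t)
q≡1+2s+2s = solve-∀

4t+4≡2s+2s : ∀ t → 4 ℕ.* t ℕ.+ 4 ≡ 2 ℕ.* suc t ℕ.+ 2 ℕ.* suc t
4t+4≡2s+2s = solve-∀

2s≡t+s+1 : ∀ t → 2 ℕ.* suc t ≡ t ℕ.+ (suc t ℕ.+ 1)
2s≡t+s+1 = solve-∀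

module QuadraticResidues (t : ℕ) (K : FiniteField (4 ℕ.* t ℕ.+ 5)) where
  open FieldDefs K
  open FieldBasics K
  open ≡-Reasoning

  -- Otherwise x ↦ x + 1 would pair up the q = 4t + 5 elements of F.
  1+1≢0 : 1# + 1# ≢ 0#
  1+1≢0 1+1≡0 = odd≢even (2 ℕ.* suc t) (# (λ x → true ∧ (x ≺ (x + 1#))))
    (trans (sym (q≡1+2s+2s t)) (trans (sym #-true) (#-involution (λ _ → true) (_+ 1#) +1+1 (λ _ _ → refl) +1-nofix)))
    where
    +1+1 : ∀ x → x + 1# + 1# ≡ x
    +1+1 x = trans (+-assoc x 1# 1#) (trans (cong (x +_) 1+1≡0) (+-identityʳ x))
    +1-nofix : ∀ x → true ≡ true → x + 1# ≢ x
    +1-nofix x _ e = 1≢0 (begin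
      1#                  ≡⟨ solve 2 (λ x o → o := (:- x) :+ (x :+ o)) refl x 1# ⟩
      - x + (x + 1#)      ≡⟨ cong (- x +_) e ⟩
      - x + x             ≡⟨ -‿inverseˡ x ⟩
      0#                  ∎)

  -‿nofix : ∀ x → x ≢ 0# → - x ≢ x
  -‿nofix x x≢0 -x≡x with zero-product (1# + 1#) x (begin
      (1# + 1#) * x    ≡⟨ solve 1 (λ x → (:1 :+ :1) :* x := x :+ x) refl x ⟩
      x + x            ≡⟨ cong (x +_) (sym -x≡x) ⟩
      x + - x          ≡⟨ -‿inverseʳ x ⟩
      0#               ∎)
  ... | inj₁ 1+1≡0 = 1+1≢0 1+1≡0
  ... | inj₂ x≡0 = x≢0 x≡0

  isNonzero : F → Bool
  isNonzero x = not (isZero x)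

  isNonzero⇒ : ∀ {x} → isNonzero x ≡ true → x ≢ 0#
  isNonzero⇒ {x} e with isZero x in z
  ... | false = ¬isZero⇒ z

  ⇒isNonzero : ∀ {x} → x ≢ 0# → isNonzero x ≡ true
  ⇒isNonzero x≢0 rewrite ⇒¬isZero x≢0 = refl

  #nonzero : # isNonzero ≡ 4 ℕ.* t ℕ.+ 4
  #nonzero = ℕ.suc-injective (begin
    suc (# isNonzero)                       ≡⟨ cong (ℕ._+ # isNonzero) (#-singleton isZero 0# (λ _ → isZero⇒) (⇒isZero refl)) ⟨
    # isZero ℕ.+ # isNonzero                 ≡⟨ #-∧-split (λ _ → true) isZero ⟨
    # (λ _ → true)                           ≡⟨ #-true ⟩
    4 ℕ.* t ℕ.+ 5                            ≡⟨ ℕ.+-suc (4 ℕ.* t) 4 ⟩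
    suc (4 ℕ.* t ℕ.+ 4)                      ∎)

  -- One representative out of each pair {x, -x} of nonzero elements.
  isPositive : F → Bool
  isPositive x = isNonzero x ∧ (x ≺ - x)

  #positive : # isPositive ≡ 2 ℕ.* suc t
  #positive = double-injective _ _ (begin
    # isPositive ℕ.+ # isPositive          ≡⟨ #-involution isNonzero -_ -‿involutive
                                                (λ x e → ⇒isNonzero (-‿≢0 x (isNonzero⇒ e)))
                                                (λ x e → -‿nofix x (isNonzero⇒ e)) ⟨
    # isNonzero                             ≡⟨ #nonzero ⟩
    4 ℕ.* t ℕ.+ 4                           ≡⟨ 4t+4≡2s+2s t ⟩
    2 ℕ.* suc t ℕ.+ 2 ℕ.* suc t             ∎)

  abs : F → F
  abs r = if r ≺ - r then r else - r

  abs-square : ∀ r → abs r * abs r ≡ r * r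
  abs-square r with r ≺ - r
  ... | true = refl
  ... | false = solve 1 (λ r → (:- r) :* (:- r) := r :* r) refl r

  abs-positive : ∀ x → isPositive x ≡ true → abs x ≡ x
  abs-positive x e rewrite proj₂ (∧-true⇒ {isNonzero x} e) = refl

  abs-negative : ∀ x → isPositive x ≡ true → abs (- x) ≡ x
  abs-negative x e with - x ≺ - - x in neg-first
  ... | false = -‿involutive x
  ... | true = ⊥-elim (true≢false (trans (sym neg-first) (trans (cong (- x ≺_) (-‿involutive x)) (≺-asym x (- x) (proj₂ (∧-true⇒ {isNonzero x} e))))))

  sqrt-≢0 : ∀ c → c ≢ 0# → IsSquare c → sqrt c ≢ 0#
  sqrt-≢0 c c≢0 sq e = c≢0 (trans (sym (sqrt-square c sq)) (trans (cong (λ z → z * z) e) (zeroʳ 0#)))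

  #residues : # isResidue ≡ 2 ℕ.* suc t
  #residues = trans (sym (#-bijection isPositive isResidue (λ x → x * x) (λ c → abs (sqrt c)) square root root-square square-root)) #positive
    where
    square : ∀ x → isPositive x ≡ true → isResidue (x * x) ≡ true
    square x e = let x≢0 = isNonzero⇒ (proj₁ (∧-true⇒ e)) in ⇒isResidue (*-≢0 x≢0 x≢0 , (x , refl))
    root : ∀ c → isResidue c ≡ true → isPositive (abs (sqrt c)) ≡ true
    root c e with isResidue⇒ e
    ... | (c≢0 , sq) with sqrt c ≺ - sqrt c in first
    ...   | true = ⇒∧-true (⇒isNonzero (sqrt-≢0 c c≢0 sq)) first
    ...   | false = ⇒∧-true (⇒isNonzero (-‿≢0 _ (sqrt-≢0 c c≢0 sq)))
                (trans (cong (- sqrt c ≺_) (-‿involutive (sqrt c)))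
                  (≺-connex (sqrt c) (- sqrt c) (λ e′ → -‿nofix _ (sqrt-≢0 c c≢0 sq) (sym e′)) first))
    root-square : ∀ x → isPositive x ≡ true → abs (sqrt (x * x)) ≡ x
    root-square x e with x*x≡y*y⇒x≡±y (sqrt (x * x)) x (sqrt-square (x * x) (x , refl))
    ... | inj₁ eq = trans (cong abs eq) (abs-positive x e)
    ... | inj₂ eq = trans (cong abs eq) (abs-negative x e)
    square-root : ∀ c → isResidue c ≡ true → abs (sqrt c) * abs (sqrt c) ≡ c
    square-root c e = trans (abs-square (sqrt c)) (sqrt-square c (proj₂ (isResidue⇒ e)))

  #nonresidues : # isNonResidue ≡ 2 ℕ.* suc t
  #nonresidues = ℕ.+-cancelˡ-≡ (2 ℕ.* suc t) _ _ (begin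
    2 ℕ.* suc t ℕ.+ # isNonResidue       ≡⟨ cong (ℕ._+ # isNonResidue) #residues ⟨
    # isResidue ℕ.+ # isNonResidue       ≡⟨ #-∧-split isNonzero isSquare ⟨
    # isNonzero                          ≡⟨ #nonzero ⟩
    4 ℕ.* t ℕ.+ 4                        ≡⟨ 4t+4≡2s+2s t ⟩
    2 ℕ.* suc t ℕ.+ 2 ℕ.* suc t          ∎)

  data Trichotomy (a : F) : Set where
    zero        : a ≡ 0# → Trichotomy a
    residue     : isResidue a ≡ true → isNonResidue a ≡ false → Trichotomy a
    nonresidue  : isResidue a ≡ false → isNonResidue a ≡ true → Trichotomy a

  trichotomy : ∀ a → Trichotomy a
  trichotomy a with isZero a in z | isSquare a in sq
  ... | true | _ = zero (isZero⇒ z)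
  ... | false | true = residue (cong₂ (λ b c → not b ∧ c) z sq) (cong₂ (λ b c → not b ∧ not c) z sq)
  ... | false | false = nonresidue (cong₂ (λ b c → not b ∧ c) z sq) (cong₂ (λ b c → not b ∧ not c) z sq)

  isResidue-0 : isResidue 0# ≡ false
  isResidue-0 rewrite ⇒isZero {0#} refl = refl

  isNonResidue-0 : isNonResidue 0# ≡ false
  isNonResidue-0 rewrite ⇒isZero {0#} refl = refl

  isResidue-1 : isResidue 1# ≡ true
  isResidue-1 = ⇒isResidue (1≢0 , (1# , solve 0 (:1 := :1 :* :1) refl))

  nonresidue⇒¬residue : ∀ {a} → isNonResidue a ≡ true → isResidue a ≡ false
  nonresidue⇒¬residue {a} with isZero a | isSquare a
  ... | false | false = λ _ → refl
  ... | false | true = λ ()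
  ... | true | _ = λ ()

  residue⇒¬nonresidue : ∀ {a} → isResidue a ≡ true → isNonResidue a ≡ false
  residue⇒¬nonresidue {a} with isZero a | isSquare a
  ... | false | true = λ _ → refl
  ... | false | false = λ ()
  ... | true | _ = λ ()

  residue-* : ∀ {a b} → InC a → InC b → InC (a * b)
  residue-* (a≢0 , (x , a≡x²)) (b≢0 , (y , b≡y²)) = *-≢0 a≢0 b≢0 ,
    (x * y , trans (cong₂ _*_ a≡x² b≡y²) (solve 2 (λ x y → (x :* x) :* (y :* y) := (x :* y) :* (x :* y)) refl x y))

  nonresidue-*-residue : ∀ {a b} → isNonResidue a ≡ true → InC b → isNonResidue (a * b) ≡ true
  nonresidue-*-residue {a} {b} n (b≢0 , (y , b≡y²)) with isNonResidue⇒ n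
  ... | (a≢0 , ¬sq) = ⇒isNonResidue (*-≢0 a≢0 b≢0) λ { (z , ab≡z²) → ¬sq (z * inv y , (begin
        a                             ≡⟨ divide-by-y² ⟨
        (a * b) * (inv y * inv y)     ≡⟨ cong (_* (inv y * inv y)) ab≡z² ⟩
        (z * z) * (inv y * inv y)     ≡⟨ solve 2 (λ z i → (z :* z) :* (i :* i) := (z :* i) :* (z :* i)) refl z (inv y) ⟩
        (z * inv y) * (z * inv y)     ∎)) }
    where
    y≢0 : y ≢ 0#
    y≢0 e = b≢0 (trans b≡y² (trans (cong (λ z → z * z) e) (zeroʳ 0#)))
    divide-by-y² : (a * b) * (inv y * inv y) ≡ a
    divide-by-y² = begin
      (a * b) * (inv y * inv y)              ≡⟨ cong (λ z → (a * z) * (inv y * inv y)) b≡y² ⟩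
      (a * (y * y)) * (inv y * inv y)        ≡⟨ solve 3 (λ a y i → (a :* (y :* y)) :* (i :* i) := a :* ((y :* i) :* (y :* i))) refl a y (inv y) ⟩
      a * ((y * inv y) * (y * inv y))        ≡⟨ cong (λ z → a * (z * z)) (*-inverseʳ y y≢0) ⟩
      a * (1# * 1#)                          ≡⟨ solve 1 (λ a → a :* (:1 :* :1) := a) refl a ⟩
      a                                      ∎

  -- n·C ⊆ N and |C| = |N|, so n·C = N.
  nonresidue-/-nonresidue : ∀ n → isNonResidue n ≡ true → ∀ z → isNonResidue z ≡ true → isResidue (z * inv n) ≡ true
  nonresidue-/-nonresidue n n∈N z z∈N with isResidue (z * inv n) in z/n
  ... | true = refl
  ... | false = ⊥-elim (true≢false (trans (sym (⇒∧-true z∈N (cong not z/n))) (#≡0⇒ outside #outside≡0 z)))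
    where
    n≢0 = proj₁ (isNonResidue⇒ n∈N)
    inside outside : F → Bool
    inside z = isNonResidue z ∧ isResidue (z * inv n)
    outside z = isNonResidue z ∧ not (isResidue (z * inv n))
    n*x/n≡x : ∀ x → n * x * inv n ≡ x
    n*x/n≡x x = trans (solve 3 (λ n x i → n :* x :* i := x :* (n :* i)) refl n x (inv n))
                  (trans (cong (x *_) (*-inverseʳ n n≢0)) (*-identityʳ x))
    x/n*n≡x : ∀ x → n * (x * inv n) ≡ x
    x/n*n≡x x = trans (solve 3 (λ n x i → n :* (x :* i) := x :* (n :* i)) refl n x (inv n))
                  (trans (cong (x *_) (*-inverseʳ n n≢0)) (*-identityʳ x))
    #inside : # isResidue ≡ # inside
    #inside = #-bijection isResidue inside (n *_) (_* inv n)
      (λ x e → ⇒∧-true (nonresidue-*-residue n∈N (isResidue⇒ e))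
                        (trans (cong isResidue (n*x/n≡x x)) e))
      (λ z e → proj₂ (∧-true⇒ {isNonResidue z} e))
      (λ x _ → n*x/n≡x x) (λ z _ → x/n*n≡x z)
    #outside≡0 : # outside ≡ 0
    #outside≡0 = ℕ.+-cancelˡ-≡ (# inside) _ _ (begin
      # inside ℕ.+ # outside      ≡⟨ #-∧-split isNonResidue (λ z → isResidue (z * inv n)) ⟨
      # isNonResidue              ≡⟨ trans #nonresidues (sym #residues) ⟩
      # isResidue                 ≡⟨ #inside ⟩
      # inside                    ≡⟨ ℕ.+-identityʳ (# inside) ⟨
      # inside ℕ.+ 0              ∎)

  nonresidue-*-nonresidue : ∀ {a b} → isNonResidue a ≡ true → isNonResidue b ≡ true → InC (a * b)
  nonresidue-*-nonresidue {a} {b} a∈N b∈N =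
    subst InC b/a*a²≡ab (residue-*-square (b * inv a) a a≢0 (isResidue⇒ (nonresidue-/-nonresidue a a∈N b b∈N)))
    where
    a≢0 = proj₁ (isNonResidue⇒ a∈N)
    b/a*a²≡ab : b * inv a * (a * a) ≡ a * b
    b/a*a²≡ab = trans (solve 3 (λ a b i → b :* i :* (a :* a) := (a :* i) :* (a :* b)) refl a b (inv a))
                  (trans (cong (_* (a * b)) (*-inverseʳ a a≢0)) (*-identityˡ _))

  isResidue-*-residue : ∀ {m} → InC m → ∀ a → isResidue (a * m) ≡ isResidue a × isNonResidue (a * m) ≡ isNonResidue a
  isResidue-*-residue {m} m∈C a with trichotomy a
  ... | zero refl = cong isResidue (zeroˡ m) , cong isNonResidue (zeroˡ m)
  ... | residue a∈C a∉N = let am∈C = ⇒isResidue (residue-* (isResidue⇒ a∈C) m∈C) in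
        trans am∈C (sym a∈C) , trans (residue⇒¬nonresidue am∈C) (sym a∉N)
  ... | nonresidue a∉C a∈N = let am∈N = nonresidue-*-residue a∈N m∈C in
        trans (nonresidue⇒¬residue am∈N) (sym a∉C) , trans am∈N (sym a∈N)

  isResidue-*-nonresidue : ∀ {m} → isNonResidue m ≡ true → ∀ a → isResidue (a * m) ≡ isNonResidue a × isNonResidue (a * m) ≡ isResidue a
  isResidue-*-nonresidue {m} m∈N a with trichotomy a
  ... | zero a≡0 = trans (cong isResidue 0≡a*m) (trans isResidue-0 (sym (trans (cong isNonResidue a≡0) isNonResidue-0))) ,
                    trans (cong isNonResidue 0≡a*m) (trans isNonResidue-0 (sym (trans (cong isResidue a≡0) isResidue-0)))
    where 0≡a*m = trans (cong (_* m) a≡0) (zeroˡ m)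
  ... | residue a∈C a∉N = let am∈N = subst (λ w → isNonResidue w ≡ true) (*-comm m a) (nonresidue-*-residue m∈N (isResidue⇒ a∈C)) in
        trans (nonresidue⇒¬residue am∈N) (sym a∉N) , trans am∈N (sym a∈C)
  ... | nonresidue a∉C a∈N = let am∈C = ⇒isResidue (nonresidue-*-nonresidue a∈N m∈N) in
        trans am∈C (sym a∈N) , trans (residue⇒¬nonresidue am∈C) (sym a∉C)

  inv-1 : inv 1# ≡ 1#
  inv-1 = trans (sym (*-identityˡ (inv 1#))) (*-inverseʳ 1# 1≢0)

  inv-[-1] : inv (- 1#) ≡ - 1#
  inv-[-1] = *-cancelˡ (- 1#) _ _ (-‿≢0 1# 1≢0)
    (trans (*-inverseʳ (- 1#) (-‿≢0 1# 1≢0)) (solve 0 (:1 := :- :1 :* :- :1) refl))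

  x+1≡0⇒x≡-1 : ∀ x → x + 1# ≡ 0# → x ≡ - 1#
  x+1≡0⇒x≡-1 x e = trans (solve 1 (λ x → x := (x :+ :1) :- :1) refl x) (trans (cong (_- 1#) e) (+-identityˡ _))

  isResidue-inv : ∀ x → x ≢ 0# → isResidue (inv x) ≡ isResidue x
  isResidue-inv x x≢0 = trans (cong isResidue (sym x*x⁻²≡x⁻¹)) (isResidue-*-square x (inv x) (inv-≢0 x x≢0))
    where
    x*x⁻²≡x⁻¹ : x * (inv x * inv x) ≡ inv x
    x*x⁻²≡x⁻¹ = trans (sym (*-assoc x (inv x) (inv x))) (trans (cong (_* inv x) (*-inverseʳ x x≢0)) (*-identityˡ _))

  -- Inversion pairs up the residues other than ±1; as |C| = 2s is even, -1 must be a residue.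
  -1-residue : InC (- 1#)
  -1-residue with trichotomy (- 1#)
  ... | zero -1≡0 = ⊥-elim (-‿≢0 1# 1≢0 -1≡0)
  ... | residue -1∈C _ = isResidue⇒ -1∈C
  ... | nonresidue -1∉C _ = ⊥-elim (odd≢even (# (λ x → generic x ∧ (x ≺ inv x))) (suc t) (sym (begin
    suc t ℕ.+ suc t                                        ≡⟨ cong (suc t ℕ.+_) (ℕ.+-identityʳ (suc t)) ⟨
    2 ℕ.* suc t                                            ≡⟨ #residues ⟨
    # isResidue                                            ≡⟨ #-∧-split isResidue (λ x → isNonzero (x - 1#)) ⟩
    # (λ x → isResidue x ∧ isNonzero (x - 1#)) ℕ.+ # (λ x → isResidue x ∧ not (isNonzero (x - 1#)))
                                                           ≡⟨ cong₂ ℕ._+_ (#-∧-split _ (λ x → isNonzero (x + 1#))) #at-1≡1 ⟩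
    (# (λ x → (isResidue x ∧ isNonzero (x - 1#)) ∧ isNonzero (x + 1#)) ℕ.+
     # (λ x → (isResidue x ∧ isNonzero (x - 1#)) ∧ not (isNonzero (x + 1#)))) ℕ.+ 1
                                                           ≡⟨ cong (λ k → (k ℕ.+ # (λ x → (isResidue x ∧ isNonzero (x - 1#)) ∧ not (isNonzero (x + 1#)))) ℕ.+ 1)
                                                                   (#-cong _ generic (λ x → ∧-assoc (isResidue x) _ _)) ⟩
    (# generic ℕ.+ # (λ x → (isResidue x ∧ isNonzero (x - 1#)) ∧ not (isNonzero (x + 1#)))) ℕ.+ 1
                                                           ≡⟨ cong₂ (λ k l → (k ℕ.+ l) ℕ.+ 1) (#-involution generic inv inv-involutive generic-inv inv-nofix) #at-minus-1≡0 ⟩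
    (# (λ x → generic x ∧ (x ≺ inv x)) ℕ.+ # (λ x → generic x ∧ (x ≺ inv x)) ℕ.+ 0) ℕ.+ 1
                                                           ≡⟨ trans (ℕ.+-comm _ 1) (cong suc (ℕ.+-identityʳ _)) ⟩
    suc (# (λ x → generic x ∧ (x ≺ inv x)) ℕ.+ # (λ x → generic x ∧ (x ≺ inv x))) ∎)))
    where
    generic : F → Bool
    generic x = isResidue x ∧ (isNonzero (x - 1#) ∧ isNonzero (x + 1#))
    generic-inv : ∀ x → generic x ≡ true → generic (inv x) ≡ true
    generic-inv x e with ∧-true⇒ {isResidue x} e
    ... | (x∈C , ±1) with ∧-true⇒ {isNonzero (x - 1#)} ±1
    ...   | (x≢1 , x≢-1) = ⇒∧-true (trans (isResidue-inv x x≢0) x∈C) (⇒∧-true (⇒isNonzero x⁻¹≢1) (⇒isNonzero x⁻¹≢-1))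
      where
      x≢0 = proj₁ (isResidue⇒ x∈C)
      x⁻¹≢1 : inv x - 1# ≢ 0#
      x⁻¹≢1 e′ = isNonzero⇒ x≢1 (trans (cong (_- 1#) (trans (sym (inv-involutive x)) (trans (cong inv (x-y≡0⇒x≡y _ _ e′)) inv-1))) (-‿inverseʳ 1#))
      x⁻¹≢-1 : inv x + 1# ≢ 0#
      x⁻¹≢-1 e′ = isNonzero⇒ x≢-1 (trans (cong (_+ 1#) (trans (sym (inv-involutive x)) (trans (cong inv (x+1≡0⇒x≡-1 _ e′)) inv-[-1]))) (-‿inverseˡ 1#))
    inv-nofix : ∀ x → generic x ≡ true → inv x ≢ x
    inv-nofix x e x⁻¹≡x with ∧-true⇒ {isResidue x} e
    ... | (x∈C , ±1) with ∧-true⇒ {isNonzero (x - 1#)} ±1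
    ...   | (x≢1 , x≢-1) with zero-product (x - 1#) (x + 1#) (begin
              (x - 1#) * (x + 1#)    ≡⟨ solve 1 (λ x → (x :- :1) :* (x :+ :1) := x :* x :- :1) refl x ⟩
              x * x - 1#             ≡⟨ cong (λ z → x * z - 1#) (sym x⁻¹≡x) ⟩
              x * inv x - 1#         ≡⟨ cong (_- 1#) (*-inverseʳ x (proj₁ (isResidue⇒ x∈C))) ⟩
              1# - 1#                ≡⟨ -‿inverseʳ 1# ⟩
              0#                     ∎)
    ...     | inj₁ x-1≡0 = isNonzero⇒ x≢1 x-1≡0
    ...     | inj₂ x+1≡0 = isNonzero⇒ x≢-1 x+1≡0
    #at-1≡1 : # (λ x → isResidue x ∧ not (isNonzero (x - 1#))) ≡ 1
    #at-1≡1 = #-singleton _ 1#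
      (λ x e → x-y≡0⇒x≡y x 1# (isZero⇒ (not-not (proj₂ (∧-true⇒ {isResidue x} e)))))
      (⇒∧-true isResidue-1 (cong not (cong not (⇒isZero (-‿inverseʳ 1#)))))
      where not-not : ∀ {b} → not (not b) ≡ true → b ≡ true
            not-not {true} _ = refl
    #at-minus-1≡0 : # (λ x → (isResidue x ∧ isNonzero (x - 1#)) ∧ not (isNonzero (x + 1#))) ≡ 0
    #at-minus-1≡0 = ⇒#≡0 _ λ x → excluded (isResidue x) (isNonzero (x - 1#)) (isNonzero (x + 1#))
      (λ x+1≡0 → trans (cong isResidue (x+1≡0⇒x≡-1 x (isZero⇒ (not-false x+1≡0)))) -1∉C)
      where
      not-false : ∀ {b} → not b ≡ false → b ≡ true
      not-false {true} _ = refl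
      excluded : ∀ a b c → (c ≡ false → a ≡ false) → ((a ∧ b) ∧ not c) ≡ false
      excluded false b c _ = refl
      excluded true b true _ = ∧-zeroʳ (true ∧ b)
      excluded true b false h with h refl
      ... | ()

  isResidue-neg : ∀ a → isResidue (- a) ≡ isResidue a × isNonResidue (- a) ≡ isNonResidue a
  isResidue-neg a = let (C , N) = isResidue-*-residue -1-residue a in
    trans (cong isResidue -a≡a*-1) C , trans (cong isNonResidue -a≡a*-1) N
    where -a≡a*-1 = solve 1 (λ a → :- a := a :* (:- :1)) refl a

  residue-neg : ∀ {a} → InC a → InC (- a)
  residue-neg {a} c = isResidue⇒ (trans (proj₁ (isResidue-neg a)) (⇒isResidue c))

  class-zero : ∀ w → isResidue w ≡ false → isNonResidue w ≡ false → w ≡ 0#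
  class-zero w w∉C w∉N with trichotomy w
  ... | zero w≡0 = w≡0
  ... | residue w∈C _ = ⊥-elim (true≢false (trans (sym w∈C) w∉C))
  ... | nonresidue _ w∈N = ⊥-elim (true≢false (trans (sym w∈N) w∉N))

  -- The cyclotomic numbers of order 2: #XY counts the z with z ∈ X and z - 1 ∈ Y.
  #CC #CN #NC #NN : ℕ
  #CC = # (λ z → isResidue z ∧ isResidue (z - 1#))
  #CN = # (λ z → isResidue z ∧ isNonResidue (z - 1#))
  #NC = # (λ z → isNonResidue z ∧ isResidue (z - 1#))
  #NN = # (λ z → isNonResidue z ∧ isNonResidue (z - 1#))

  private
    drop-¬C-given-N : ∀ a c n → (n ≡ true → c ≡ false) → ((a ∧ not c) ∧ n) ≡ (a ∧ n)
    drop-¬C-given-N a c false _ = trans (∧-zeroʳ _) (sym (∧-zeroʳ a))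
    drop-¬C-given-N a c true h rewrite h refl = ∧-identityʳ _

  #C≡#CC+#CN+1 : 2 ℕ.* suc t ≡ #CC ℕ.+ (#CN ℕ.+ 1)
  #C≡#CC+#CN+1 = trans (sym #residues)
    (trans (#-∧-split isResidue (λ z → isResidue (z - 1#)))
      (cong (#CC ℕ.+_) (trans (#-∧-split _ (λ z → isNonResidue (z - 1#))) (cong₂ ℕ._+_ #CN′ #at-1≡1))))
    where
    #CN′ : # (λ z → (isResidue z ∧ not (isResidue (z - 1#))) ∧ isNonResidue (z - 1#)) ≡ #CN
    #CN′ = #-cong _ _ (λ z → drop-¬C-given-N (isResidue z) (isResidue (z - 1#)) (isNonResidue (z - 1#)) nonresidue⇒¬residue)
    neither : ∀ a b c → ((a ∧ not b) ∧ not c) ≡ true → b ≡ false × c ≡ false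
    neither true false false _ = refl , refl
    #at-1≡1 : # (λ z → (isResidue z ∧ not (isResidue (z - 1#))) ∧ not (isNonResidue (z - 1#))) ≡ 1
    #at-1≡1 = #-singleton _ 1#
      (λ z e → let (b , c) = neither (isResidue z) _ _ e in x-y≡0⇒x≡y z 1# (class-zero (z - 1#) b c))
      (trans (cong (λ b → (b ∧ not (isResidue (1# - 1#))) ∧ not (isNonResidue (1# - 1#))) isResidue-1)
        (cong₂ (λ b b′ → (true ∧ not b) ∧ not b′) (trans (cong isResidue (-‿inverseʳ 1#)) isResidue-0)
                                                 (trans (cong isNonResidue (-‿inverseʳ 1#)) isNonResidue-0)))

  #N≡#NC+#NN : 2 ℕ.* suc t ≡ #NC ℕ.+ (#NN ℕ.+ 0)
  #N≡#NC+#NN = trans (sym #nonresidues)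
    (trans (#-∧-split isNonResidue (λ z → isResidue (z - 1#)))
      (cong (#NC ℕ.+_) (trans (#-∧-split _ (λ z → isNonResidue (z - 1#))) (cong₂ ℕ._+_ #NN′ #none))))
    where
    #NN′ : # (λ z → (isNonResidue z ∧ not (isResidue (z - 1#))) ∧ isNonResidue (z - 1#)) ≡ #NN
    #NN′ = #-cong _ _ (λ z → drop-¬C-given-N (isNonResidue z) (isResidue (z - 1#)) (isNonResidue (z - 1#)) nonresidue⇒¬residue)
    excluded : ∀ z a b c → isNonResidue z ≡ a → isResidue (z - 1#) ≡ b → isNonResidue (z - 1#) ≡ c → ((a ∧ not b) ∧ not c) ≡ false
    excluded z false b c _ _ _ = refl
    excluded z true true c _ _ _ = refl
    excluded z true false true _ _ _ = refl
    excluded z true false false z∈N b c = ⊥-elim (true≢false (trans (sym z∈N)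
      (trans (cong isNonResidue (x-y≡0⇒x≡y z 1# (class-zero _ b c))) (residue⇒¬nonresidue isResidue-1))))
    #none : # (λ z → (isNonResidue z ∧ not (isResidue (z - 1#))) ∧ not (isNonResidue (z - 1#))) ≡ 0
    #none = ⇒#≡0 _ (λ z → excluded z _ _ _ refl refl refl)

  1-z≡-[z-1] : ∀ z → 1# - z ≡ - (z - 1#)
  1-z≡-[z-1] z = solve 1 (λ z → :1 :- z := :- (z :- :1)) refl z

  #CN≡#NC : #CN ≡ #NC
  #CN≡#NC = #-permutation _ _ (λ z → 1# - z) (λ z → 1# - z) 1-[1-z] 1-[1-z] classes
    where
    1-[1-z] : ∀ z → 1# - (1# - z) ≡ z
    1-[1-z] z = solve 1 (λ z → :1 :- (:1 :- z) := z) refl z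
    classes : ∀ z → (isResidue z ∧ isNonResidue (z - 1#)) ≡ (isNonResidue (1# - z) ∧ isResidue ((1# - z) - 1#))
    classes z = trans (∧-comm (isResidue z) _) (cong₂ _∧_
      (sym (trans (cong isNonResidue (1-z≡-[z-1] z)) (proj₂ (isResidue-neg (z - 1#)))))
      (sym (trans (cong isResidue (solve 1 (λ z → (:1 :- z) :- :1 := :- z) refl z)) (proj₁ (isResidue-neg z)))))

  isNonResidue-inv : ∀ z → isNonResidue (inv z) ≡ isNonResidue z
  isNonResidue-inv z = by-cases (z ≟ 0#)
    where
    by-cases : Dec (z ≡ 0#) → isNonResidue (inv z) ≡ isNonResidue z
    by-cases (yes z≡0) = cong isNonResidue (trans (cong inv z≡0) (trans inv-0 (sym z≡0)))
    by-cases (no z≢0) = trans (cong isNonResidue (sym z*z⁻²≡z⁻¹)) (proj₂ (isResidue-*-residue z⁻²∈C z))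
      where
      z⁻²∈C : InC (inv z * inv z)
      z⁻²∈C = subst InC (*-identityˡ _) (residue-*-square 1# (inv z) (inv-≢0 z z≢0) (isResidue⇒ isResidue-1))
      z*z⁻²≡z⁻¹ : z * (inv z * inv z) ≡ inv z
      z*z⁻²≡z⁻¹ = trans (sym (*-assoc z (inv z) (inv z))) (trans (cong (_* inv z) (*-inverseʳ z z≢0)) (*-identityˡ _))

  #NN≡#NC : #NN ≡ #NC
  #NN≡#NC = #-permutation _ _ inv inv inv-involutive inv-involutive classes
    where
    classes : ∀ z → (isNonResidue z ∧ isNonResidue (z - 1#)) ≡ (isNonResidue (inv z) ∧ isResidue (inv z - 1#))
    classes z with trichotomy z
    ... | zero z≡0 = trans (cong (λ w → isNonResidue w ∧ isNonResidue (w - 1#)) z≡0)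
                       (trans (cong (_∧ isNonResidue (0# - 1#)) isNonResidue-0)
                         (sym (cong (_∧ isResidue (inv z - 1#)) (trans (isNonResidue-inv z) (trans (cong isNonResidue z≡0) isNonResidue-0)))))
    ... | residue _ z∉N = trans (cong (_∧ isNonResidue (z - 1#)) z∉N) (sym (cong (_∧ isResidue (inv z - 1#)) (trans (isNonResidue-inv z) z∉N)))
    ... | nonresidue _ z∈N = trans (cong (_∧ isNonResidue (z - 1#)) z∈N)
                              (sym (trans (cong (_∧ isResidue (inv z - 1#)) (trans (isNonResidue-inv z) z∈N))
                                (trans (cong isResidue z⁻¹-1≡[1-z]z⁻¹)
                                  (trans (proj₁ (isResidue-*-nonresidue (trans (isNonResidue-inv z) z∈N) (1# - z)))
                                    (trans (cong isNonResidue (1-z≡-[z-1] z)) (proj₂ (isResidue-neg (z - 1#))))))))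
      where
      z≢0 = proj₁ (isNonResidue⇒ z∈N)
      z⁻¹-1≡[1-z]z⁻¹ : inv z - 1# ≡ (1# - z) * inv z
      z⁻¹-1≡[1-z]z⁻¹ = trans (cong (λ w → inv z - w) (sym (*-inverseʳ z z≢0)))
                         (solve 2 (λ z i → i :- z :* i := (:1 :- z) :* i) refl z (inv z))

  #NN≡s : #NN ≡ suc t
  #NN≡s = double-injective #NN (suc t) (sym (begin
    suc t ℕ.+ suc t             ≡⟨ cong (suc t ℕ.+_) (ℕ.+-identityʳ (suc t)) ⟨
    2 ℕ.* suc t                 ≡⟨ #N≡#NC+#NN ⟩
    #NC ℕ.+ (#NN ℕ.+ 0)         ≡⟨ cong₂ (λ a b → a ℕ.+ b) (sym #NN≡#NC) (ℕ.+-identityʳ #NN) ⟩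
    #NN ℕ.+ #NN                 ∎))

  #CC≡t : #CC ≡ t
  #CC≡t = ℕ.+-cancelʳ-≡ (suc t ℕ.+ 1) #CC t (begin
    #CC ℕ.+ (suc t ℕ.+ 1)       ≡⟨ cong (λ k → #CC ℕ.+ (k ℕ.+ 1)) (trans #CN≡#NC (trans (sym #NN≡#NC) #NN≡s)) ⟨
    #CC ℕ.+ (#CN ℕ.+ 1)         ≡⟨ #C≡#CC+#CN+1 ⟨
    2 ℕ.* suc t                 ≡⟨ 2s≡t+s+1 t ⟩
    t ℕ.+ (suc t ℕ.+ 1)         ∎)

  commonNeighbours : F → F → ℕ
  commonNeighbours α β = # (λ γ → isResidue (α - γ) ∧ isResidue (β - γ))

  -- The affine substitution γ ↦ (α - γ)/(α - β) sends α, β to 0, 1.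
  commonNeighbours-normalise : ∀ α β (r : F → Bool) → α - β ≢ 0# →
    (∀ z → (isResidue (z * (α - β)) ∧ isResidue ((z - 1#) * (α - β))) ≡ r z) → commonNeighbours α β ≡ # r
  commonNeighbours-normalise α β r α-β≢0 classes =
    #-permutation _ r f g g∘f f∘g (λ γ → trans (cong₂ _∧_ (cong isResidue (α-γ≡ γ)) (cong isResidue (β-γ≡ γ))) (classes (f γ)))
    where
    d = α - β
    i = inv d
    d*i≡1 : d * i ≡ 1#
    d*i≡1 = *-inverseʳ d α-β≢0
    f g : F → F
    f γ = (α - γ) * i
    g z = α - d * z
    g∘f : ∀ γ → g (f γ) ≡ γ
    g∘f γ = trans (solve 4 (λ a g d i → a :- d :* ((a :- g) :* i) := a :- (a :- g) :* (d :* i)) refl α γ d i)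
              (trans (cong (λ w → α - (α - γ) * w) d*i≡1) (solve 2 (λ a g → a :- (a :- g) :* :1 := g) refl α γ))
    f∘g : ∀ z → f (g z) ≡ z
    f∘g z = trans (solve 4 (λ a z d i → (a :- (a :- d :* z)) :* i := z :* (d :* i)) refl α z d i)
              (trans (cong (z *_) d*i≡1) (*-identityʳ z))
    α-γ≡ : ∀ γ → α - γ ≡ f γ * d
    α-γ≡ γ = sym (trans (solve 4 (λ a g d i → ((a :- g) :* i) :* d := (a :- g) :* (d :* i)) refl α γ d i)
               (trans (cong ((α - γ) *_) d*i≡1) (*-identityʳ _)))
    β-γ≡ : ∀ γ → β - γ ≡ (f γ - 1#) * d
    β-γ≡ γ = sym (trans (solve 4 (λ a b g i → ((a :- g) :* i :- :1) :* (a :- b) := (a :- g) :* ((a :- b) :* i) :- (a :- b)) refl α β γ i)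
               (trans (cong (λ w → (α - γ) * w - (α - β)) d*i≡1) (solve 3 (λ a b g → (a :- g) :* :1 :- (a :- b) := b :- g) refl α β γ)))

  commonNeighbours-residue : ∀ α β → InC (α - β) → commonNeighbours α β ≡ t
  commonNeighbours-residue α β α-β∈C = trans
    (commonNeighbours-normalise α β _ (proj₁ α-β∈C) (λ z → cong₂ _∧_ (proj₁ (isResidue-*-residue α-β∈C z)) (proj₁ (isResidue-*-residue α-β∈C (z - 1#)))))
    #CC≡t

  commonNeighbours-nonresidue : ∀ α β → isNonResidue (α - β) ≡ true → commonNeighbours α β ≡ suc t
  commonNeighbours-nonresidue α β α-β∈N = trans
    (commonNeighbours-normalise α β _ (proj₁ (isNonResidue⇒ α-β∈N)) (λ z → cong₂ _∧_ (proj₁ (isResidue-*-nonresidue α-β∈N z)) (proj₁ (isResidue-*-nonresidue α-β∈N (z - 1#)))))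
    #NN≡s

  #neighbours : ∀ α → # (λ γ → isResidue (α - γ)) ≡ 2 ℕ.* suc t
  #neighbours α = trans (#-permutation _ isResidue (λ γ → α - γ) (λ γ → α - γ) α-[α-γ] α-[α-γ] (λ _ → refl)) #residues
    where α-[α-γ] : ∀ γ → α - (α - γ) ≡ γ
          α-[α-γ] γ = solve 2 (λ a g → a :- (a :- g) := g) refl α γ

  -- The quadratic character, with the junk value χ 0 = -.
  χ : F → Sign
  χ a = if isResidue a then Sign.+ else Sign.-

  χ-* : ∀ a b → a ≢ 0# → b ≢ 0# → χ (a * b) ≡ χ a Sign.* χ b
  χ-* a b a≢0 b≢0 with trichotomy a | trichotomy b
  ... | zero a≡0 | _ = ⊥-elim (a≢0 a≡0)
  ... | _ | zero b≡0 = ⊥-elim (b≢0 b≡0)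
  ... | residue a∈C _ | residue b∈C _ rewrite proj₁ (isResidue-*-residue (isResidue⇒ b∈C) a) | a∈C | b∈C = refl
  ... | residue a∈C a∉N | nonresidue b∉C b∈N rewrite proj₁ (isResidue-*-nonresidue b∈N a) | a∉N | a∈C | b∉C = refl
  ... | nonresidue a∉C _ | residue b∈C _ rewrite proj₁ (isResidue-*-residue (isResidue⇒ b∈C) a) | a∉C | b∈C = refl
  ... | nonresidue a∉C a∈N | nonresidue b∉C b∈N rewrite proj₁ (isResidue-*-nonresidue b∈N a) | a∈N | a∉C | b∉C = refl

module ProjectiveLine {q : ℕ} (K : FiniteField q) where
  open FieldDefs K
  open FieldBasics K
  open ≡-Reasoning

  det-·ˡ : ∀ c w w′ → det (c · w) w′ ≡ c * det w w′
  det-·ˡ c (a , b) (x , y) = solve 5 (λ c a b x y → c :* a :* y :- c :* b :* x := c :* (a :* y :- b :* x)) refl c a b x y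

  det-·ʳ : ∀ c w w′ → det w (c · w′) ≡ c * det w w′
  det-·ʳ c (a , b) (x , y) = solve 5 (λ c a b x y → a :* (c :* y) :- b :* (c :* x) := c :* (a :* y :- b :* x)) refl c a b x y

  det-self : ∀ w → det w w ≡ 0#
  det-self (a , b) = solve 2 (λ a b → a :* b :- b :* a := :0) refl a b

  det-antisym : ∀ w w′ → det w′ w ≡ - det w w′
  det-antisym (a , b) (x , y) = solve 4 (λ a b x y → x :* b :- y :* a := :- (a :* y :- b :* x)) refl a b x y

  det-0V : ∀ w → det w 0V ≡ 0#
  det-0V (a , b) = solve 2 (λ a b → a :* :0 :- b :* :0 := :0) refl a b

  det≢0⇒≢0ʳ : ∀ u w → det u w ≢ 0# → w ≢ 0V
  det≢0⇒≢0ʳ u w d≢0 refl = d≢0 (det-0V u)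

  det≢0⇒≢0ˡ : ∀ u w → det u w ≢ 0# → u ≢ 0V
  det≢0⇒≢0ˡ u w d≢0 refl = d≢0 (trans (det-antisym w 0V) (trans (cong -_ (det-0V w)) -0#≈0#))

  det-swap-≢0 : ∀ u v → det u v ≢ 0# → det v u ≢ 0#
  det-swap-≢0 u v d≢0 e = d≢0 (trans (sym (-‿involutive _)) (trans (cong -_ (sym (det-antisym u v))) (trans (cong -_ e) -0#≈0#)))

  ·-identityˡ : ∀ w → 1# · w ≡ w
  ·-identityˡ (a , b) = cong₂ _,_ (*-identityˡ a) (*-identityˡ b)

  ·-assoc : ∀ a b w → a · (b · w) ≡ (a * b) · w
  ·-assoc a b (x , y) = cong₂ _,_ (sym (*-assoc a b x)) (sym (*-assoc a b y))

  ·-scalar-≢0 : ∀ c w w′ → w′ ≢ 0V → w′ ≡ c · w → c ≢ 0#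
  ·-scalar-≢0 c (a , b) w′ w′≢0 w′≡cw refl = w′≢0 (trans w′≡cw (cong₂ _,_ (zeroˡ a) (zeroˡ b)))

  det≡0⇒parallel : ∀ w w′ → w ≢ 0V → w′ ≢ 0V → det w w′ ≡ 0# → Σ F λ c → c ≢ 0# × w′ ≡ c · w
  det≡0⇒parallel (w₁ , w₂) (x₁ , x₂) w≢0 w′≢0 d≡0 with w₁ ≟ 0# | w₂ ≟ 0#
  ... | yes w₁≡0 | yes w₂≡0 = ⊥-elim (w≢0 (cong₂ _,_ w₁≡0 w₂≡0))
  ... | no w₁≢0 | _ = c , ·-scalar-≢0 c _ _ w′≢0 w′≡cw , w′≡cw
    where
    c = x₁ * inv w₁
    w′≡cw : (x₁ , x₂) ≡ c · (w₁ , w₂)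
    w′≡cw = cong₂ _,_
      (sym (trans (*-assoc x₁ (inv w₁) w₁) (trans (cong (x₁ *_) (*-inverseˡ w₁ w₁≢0)) (*-identityʳ x₁))))
      (*-cancelˡ w₁ _ _ w₁≢0 (begin
        w₁ * x₂                      ≡⟨ x-y≡0⇒x≡y _ _ d≡0 ⟩
        w₂ * x₁                      ≡⟨ *-identityˡ _ ⟨
        1# * (w₂ * x₁)               ≡⟨ cong (_* (w₂ * x₁)) (*-inverseʳ w₁ w₁≢0) ⟨
        (w₁ * inv w₁) * (w₂ * x₁)    ≡⟨ solve 4 (λ w₁ w₂ x₁ i → (w₁ :* i) :* (w₂ :* x₁) := w₁ :* (x₁ :* i :* w₂)) refl w₁ w₂ x₁ (inv w₁) ⟩
        w₁ * (x₁ * inv w₁ * w₂)      ∎))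
  ... | yes w₁≡0 | no w₂≢0 = c , ·-scalar-≢0 c _ _ w′≢0 w′≡cw , w′≡cw
    where
    c = x₂ * inv w₂
    w₂x₁≡0 : w₂ * x₁ ≡ 0#
    w₂x₁≡0 = begin
      w₂ * x₁                        ≡⟨ solve 3 (λ w₂ x₁ x₂ → w₂ :* x₁ := :- (:0 :* x₂ :- w₂ :* x₁)) refl w₂ x₁ x₂ ⟩
      - (0# * x₂ - w₂ * x₁)          ≡⟨ cong (λ z → - (z * x₂ - w₂ * x₁)) w₁≡0 ⟨
      - det (w₁ , w₂) (x₁ , x₂)      ≡⟨ cong -_ d≡0 ⟩
      - 0#                           ≡⟨ -0#≈0# ⟩
      0#                             ∎
    w′≡cw : (x₁ , x₂) ≡ c · (w₁ , w₂)
    w′≡cw = cong₂ _,_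
      (trans (*-cancelˡ w₂ _ _ w₂≢0 (trans w₂x₁≡0 (sym (zeroʳ w₂)))) (trans (sym (zeroʳ c)) (cong (c *_) (sym w₁≡0))))
      (sym (trans (*-assoc x₂ (inv w₂) w₂) (trans (cong (x₂ *_) (*-inverseˡ w₂ w₂≢0)) (*-identityʳ x₂))))

  ≈-refl : ∀ x → x ≈ x
  ≈-refl x = 1# , 1≢0 , sym (·-identityˡ (vec x))

  ≈-sym : ∀ x y → x ≈ y → y ≈ x
  ≈-sym x y (c , c≢0 , y≡cx) = inv c , inv-≢0 c c≢0 , sym (begin
    inv c · vec y            ≡⟨ cong (inv c ·_) y≡cx ⟩
    inv c · (c · vec x)      ≡⟨ ·-assoc (inv c) c (vec x) ⟩
    (inv c * c) · vec x      ≡⟨ cong (_· vec x) (*-inverseˡ c c≢0) ⟩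
    1# · vec x               ≡⟨ ·-identityˡ (vec x) ⟩
    vec x                    ∎)

  ≈-trans : ∀ x y z → x ≈ y → y ≈ z → x ≈ z
  ≈-trans x y z (c , c≢0 , y≡cx) (d , d≢0 , z≡dy) =
    d * c , *-≢0 d≢0 c≢0 , trans z≡dy (trans (cong (d ·_) y≡cx) (·-assoc d c (vec x)))

  LineOf-resp-≈ : ∀ w x y → LineOf w x → x ≈ y → LineOf w y
  LineOf-resp-≈ w x y (c , c≢0 , x≡cw) (k , k≢0 , y≡kx) =
    k * c , *-≢0 k≢0 c≢0 , trans y≡kx (trans (cong (k ·_) x≡cw) (·-assoc k c w))

  LineOf-self : ∀ w (w≢0 : w ≢ 0V) → LineOf w (w , w≢0)
  LineOf-self w _ = 1# , 1≢0 , sym (·-identityˡ w)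

  LineOf⇒det≡0 : ∀ {w x} → LineOf w x → det w (vec x) ≡ 0#
  LineOf⇒det≡0 {w} (c , _ , x≡cw) = trans (cong (det w) x≡cw) (trans (det-·ʳ c w w) (trans (cong (c *_) (det-self w)) (zeroʳ c)))

  det≡0⇒LineOf : ∀ w x → w ≢ 0V → det w (vec x) ≡ 0# → LineOf w x
  det≡0⇒LineOf w x w≢0 = det≡0⇒parallel w (vec x) w≢0 (proj₂ x)

  ≈⇒det≡0 : ∀ {x y} → x ≈ y → det (vec x) (vec y) ≡ 0#
  ≈⇒det≡0 {x} {y} = LineOf⇒det≡0 {vec x} {y}

  det≡0⇒≈ : ∀ x y → det (vec x) (vec y) ≡ 0# → x ≈ y
  det≡0⇒≈ x y = det≡0⇒parallel (vec x) (vec y) (proj₂ x) (proj₂ y)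

  det≡0-trans : ∀ w → w ≢ 0V → ∀ x y → det w (vec x) ≡ 0# → det w (vec y) ≡ 0# → det (vec x) (vec y) ≡ 0#
  det≡0-trans w w≢0 x y wx≡0 wy≡0 = ≈⇒det≡0 {x} {y}
    (≈-trans x (w , w≢0) y (≈-sym (w , w≢0) x (det≡0⇒LineOf w x w≢0 wx≡0)) (det≡0⇒LineOf w y w≢0 wy≡0))

  -- Γ u v is read off the sign of this form (see Γ⇒Q∈C and Q∈C⇒Γ).
  Q : V → V → Point → Point → F
  Q u v x y = det u v * det (vec x) (vec y) * det u (vec x) * det u (vec y)

  Q-≈-zero : ∀ u v {x y} → det (vec x) (vec y) ≡ 0# → Q u v x y ≡ 0#
  Q-≈-zero u v {x} {y} e rewrite e = solve 3 (λ D a b → D :* :0 :* a :* b := :0) refl (det u v) (det u (vec x)) (det u (vec y))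

  Q-zeroˡ : ∀ u v {x} y → det u (vec x) ≡ 0# → Q u v x y ≡ 0#
  Q-zeroˡ u v {x} y e rewrite e = solve 3 (λ D d b → D :* d :* :0 :* b := :0) refl (det u v) (det (vec x) (vec y)) (det u (vec y))

  Q-zeroʳ : ∀ u v x {y} → det u (vec y) ≡ 0# → Q u v x y ≡ 0#
  Q-zeroʳ u v x {y} e rewrite e = solve 3 (λ D d a → D :* d :* a :* :0 := :0) refl (det u v) (det (vec x) (vec y)) (det u (vec x))

  Q≢0⇒ : ∀ u v x y → Q u v x y ≢ 0# → det (vec x) (vec y) ≢ 0# × det u (vec x) ≢ 0# × det u (vec y) ≢ 0#
  Q≢0⇒ u v x y Q≢0 = (λ e → Q≢0 (Q-≈-zero u v {x} {y} e)) , (λ e → Q≢0 (Q-zeroˡ u v {x} y e)) , (λ e → Q≢0 (Q-zeroʳ u v x {y} e))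

  Q-antisym : ∀ u v x y → Q u v y x ≡ - Q u v x y
  Q-antisym u v x y = trans (cong (λ z → det u v * z * det u (vec y) * det u (vec x)) (det-antisym (vec x) (vec y)))
    (solve 4 (λ D e a b → D :* (:- e) :* b :* a := :- (D :* e :* a :* b)) refl (det u v) (det (vec x) (vec y)) (det u (vec x)) (det u (vec y)))

  app-· : ∀ φ k w → app φ (k · w) ≡ k · app φ w
  app-· (a , b , c , d) k (w₁ , w₂) = cong₂ _,_
    (solve 5 (λ a b k w₁ w₂ → a :* (k :* w₁) :+ b :* (k :* w₂) := k :* (a :* w₁ :+ b :* w₂)) refl a b k w₁ w₂)
    (solve 5 (λ c d k w₁ w₂ → c :* (k :* w₁) :+ d :* (k :* w₂) := k :* (c :* w₁ :+ d :* w₂)) refl c d k w₁ w₂)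

  app-affine : ∀ φ α u v → app φ (α · u ⊕ v) ≡ α · app φ u ⊕ app φ v
  app-affine (a , b , c , d) α (u₁ , u₂) (v₁ , v₂) = cong₂ _,_
    (solve 7 (λ a b u₁ u₂ v₁ v₂ α → a :* (α :* u₁ :+ v₁) :+ b :* (α :* u₂ :+ v₂) := α :* (a :* u₁ :+ b :* u₂) :+ (a :* v₁ :+ b :* v₂)) refl a b u₁ u₂ v₁ v₂ α)
    (solve 7 (λ c d u₁ u₂ v₁ v₂ α → c :* (α :* u₁ :+ v₁) :+ d :* (α :* u₂ :+ v₂) := α :* (c :* u₁ :+ d :* u₂) :+ (c :* v₁ :+ d :* v₂)) refl c d u₁ u₂ v₁ v₂ α)

  det-app : ∀ φ w w′ → det (app φ w) (app φ w′) ≡ detM φ * det w w′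
  det-app (p , q , r , s) (a₁ , a₂) (b₁ , b₂) =
    solve 8 (λ p q r s a₁ a₂ b₁ b₂ → (p :* a₁ :+ q :* a₂) :* (r :* b₁ :+ s :* b₂) :- (r :* a₁ :+ s :* a₂) :* (p :* b₁ :+ q :* b₂)
                                    := (p :* s :- q :* r) :* (a₁ :* b₂ :- a₂ :* b₁)) refl p q r s a₁ a₂ b₁ b₂

  complement : ∀ w → w ≢ 0V → ∀ d → Σ V λ w′ → det w w′ ≡ d
  complement (w₁ , w₂) w≢0 d with w₁ ≟ 0# | w₂ ≟ 0#
  ... | yes w₁≡0 | yes w₂≡0 = ⊥-elim (w≢0 (cong₂ _,_ w₁≡0 w₂≡0))
  ... | no w₁≢0 | _ = (0# , d * inv w₁) ,
    trans (solve 4 (λ w₁ w₂ d i → w₁ :* (d :* i) :- w₂ :* :0 := d :* (w₁ :* i)) refl w₁ w₂ d (inv w₁))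
          (trans (cong (d *_) (*-inverseʳ w₁ w₁≢0)) (*-identityʳ d))
  ... | yes _ | no w₂≢0 = (- (d * inv w₂) , 0#) ,
    trans (solve 4 (λ w₁ w₂ d i → w₁ :* :0 :- w₂ :* (:- (d :* i)) := d :* (w₂ :* i)) refl w₁ w₂ d (inv w₂))
          (trans (cong (d *_) (*-inverseʳ w₂ w₂≢0)) (*-identityʳ d))

  -- The matrix sending the basis (u, v) to (w, w′).
  transfer : V → V → V → V → Mat
  transfer (u₁ , u₂) (v₁ , v₂) (w₁ , w₂) (w′₁ , w′₂) =
    e * (w₁ * v₂ - w′₁ * u₂) , e * (w′₁ * u₁ - w₁ * v₁) , e * (w₂ * v₂ - w′₂ * u₂) , e * (w′₂ * u₁ - w₂ * v₁)
    where e = inv (u₁ * v₂ - u₂ * v₁)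

  module _ (u v w w′ : V) (uv-basis : det u v ≢ 0#) where
    private
      e = inv (det u v)
      e*D≡1 : e * det u v ≡ 1#
      e*D≡1 = *-inverseˡ (det u v) uv-basis
      cancel : ∀ z → (e * det u v) * z ≡ z
      cancel z = trans (cong (_* z) e*D≡1) (*-identityˡ z)

    transfer-u : app (transfer u v w w′) u ≡ w
    transfer-u = cong₂ _,_ (trans (image (proj₁ w) (proj₁ w′)) (cancel _)) (trans (image (proj₂ w) (proj₂ w′)) (cancel _))
      where
      image : ∀ a a′ → e * (a * proj₂ v - a′ * proj₂ u) * proj₁ u + e * (a′ * proj₁ u - a * proj₁ v) * proj₂ u ≡ (e * det u v) * a
      image a a′ = solve 7 (λ e a a′ u₁ u₂ v₁ v₂ → e :* (a :* v₂ :- a′ :* u₂) :* u₁ :+ e :* (a′ :* u₁ :- a :* v₁) :* u₂ := (e :* (u₁ :* v₂ :- u₂ :* v₁)) :* a)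
                     refl e a a′ (proj₁ u) (proj₂ u) (proj₁ v) (proj₂ v)

    transfer-v : app (transfer u v w w′) v ≡ w′
    transfer-v = cong₂ _,_ (trans (image (proj₁ w) (proj₁ w′)) (cancel _)) (trans (image (proj₂ w) (proj₂ w′)) (cancel _))
      where
      image : ∀ a a′ → e * (a * proj₂ v - a′ * proj₂ u) * proj₁ v + e * (a′ * proj₁ u - a * proj₁ v) * proj₂ v ≡ (e * det u v) * a′
      image a a′ = solve 7 (λ e a a′ u₁ u₂ v₁ v₂ → e :* (a :* v₂ :- a′ :* u₂) :* v₁ :+ e :* (a′ :* u₁ :- a :* v₁) :* v₂ := (e :* (u₁ :* v₂ :- u₂ :* v₁)) :* a′)
                     refl e a a′ (proj₁ u) (proj₂ u) (proj₁ v) (proj₂ v)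

    detM-transfer : detM (transfer u v w w′) ≡ e * det w w′
    detM-transfer = trans (solve 9 (λ e w₁ w₂ w′₁ w′₂ u₁ u₂ v₁ v₂ →
        e :* (w₁ :* v₂ :- w′₁ :* u₂) :* (e :* (w′₂ :* u₁ :- w₂ :* v₁)) :- e :* (w′₁ :* u₁ :- w₁ :* v₁) :* (e :* (w₂ :* v₂ :- w′₂ :* u₂))
        := (e :* (w₁ :* w′₂ :- w₂ :* w′₁)) :* (e :* (u₁ :* v₂ :- u₂ :* v₁))) refl e (proj₁ w) (proj₂ w) (proj₁ w′) (proj₂ w′) (proj₁ u) (proj₂ u) (proj₁ v) (proj₂ v))
      (trans (cong ((e * det w w′) *_) e*D≡1) (*-identityʳ _))

-- The chart α ↦ ⟨α u + v⟩ identifies F with X^u; coord is its inverse, ⟨w⟩ ↦ det(w,v)/det(u,w).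
module AffineChart {q : ℕ} (K : FiniteField q) (u v : FieldDefs.V K) (uv-basis : FieldDefs.Basis K u v) where
  open FieldDefs K
  open FieldBasics K
  open ProjectiveLine K
  open ≡-Reasoning

  D : F
  D = det u v

  u≢0 : u ≢ 0V
  u≢0 = det≢0⇒≢0ˡ u v uv-basis

  Xu⇒det≢0 : ∀ {x} → Xu u x → det u (vec x) ≢ 0#
  Xu⇒det≢0 {x} x∉⟨u⟩ d≡0 = x∉⟨u⟩ (det≡0⇒LineOf u x u≢0 d≡0)

  det≢0⇒Xu : ∀ {x} → det u (vec x) ≢ 0# → Xu u x
  det≢0⇒Xu {x} d≢0 x∈⟨u⟩ = d≢0 (LineOf⇒det≡0 {u} {x} x∈⟨u⟩)

  affine : F → V
  affine α = α · u ⊕ v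

  coord : Point → F
  coord x = det (vec x) v * inv (det u (vec x))

  det-u-affine : ∀ α → det u (affine α) ≡ D
  det-u-affine α = solve 5 (λ a u₁ u₂ v₁ v₂ → u₁ :* (a :* u₂ :+ v₂) :- u₂ :* (a :* u₁ :+ v₁) := u₁ :* v₂ :- u₂ :* v₁) refl
    α (proj₁ u) (proj₂ u) (proj₁ v) (proj₂ v)

  point : F → Point
  point α = affine α , det≢0⇒≢0ʳ u (affine α) (λ e → uv-basis (trans (sym (det-u-affine α)) e))

  LineOf-point : ∀ α → LineOf (affine α) (point α)
  LineOf-point α = LineOf-self (affine α) (proj₂ (point α))

  -- Cramer's rule: det(w,v) u + det(u,w) v = det(u,v) w.
  LineOf-coord : ∀ x → det u (vec x) ≢ 0# → LineOf (coord x · u ⊕ v) x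
  LineOf-coord x a≢0 = a * inv D , *-≢0 a≢0 (inv-≢0 D uv-basis) ,
    cong₂ _,_ (sym (rescale (cramer₁ (proj₁ u) (proj₂ u) (proj₁ v) (proj₂ v) (proj₁ (vec x)) (proj₂ (vec x)))))
              (sym (rescale (cramer₂ (proj₁ u) (proj₂ u) (proj₁ v) (proj₂ v) (proj₁ (vec x)) (proj₂ (vec x)))))
    where
    a = det u (vec x)
    cramer₁ : ∀ u₁ u₂ v₁ v₂ w₁ w₂ → (w₁ * v₂ - w₂ * v₁) * u₁ + (u₁ * w₂ - u₂ * w₁) * v₁ ≡ (u₁ * v₂ - u₂ * v₁) * w₁
    cramer₁ = solve 6 (λ u₁ u₂ v₁ v₂ w₁ w₂ → (w₁ :* v₂ :- w₂ :* v₁) :* u₁ :+ (u₁ :* w₂ :- u₂ :* w₁) :* v₁ := (u₁ :* v₂ :- u₂ :* v₁) :* w₁) refl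
    cramer₂ : ∀ u₁ u₂ v₁ v₂ w₁ w₂ → (w₁ * v₂ - w₂ * v₁) * u₂ + (u₁ * w₂ - u₂ * w₁) * v₂ ≡ (u₁ * v₂ - u₂ * v₁) * w₂
    cramer₂ = solve 6 (λ u₁ u₂ v₁ v₂ w₁ w₂ → (w₁ :* v₂ :- w₂ :* v₁) :* u₂ :+ (u₁ :* w₂ :- u₂ :* w₁) :* v₂ := (u₁ :* v₂ :- u₂ :* v₁) :* w₂) refl
    rescale : ∀ {b ui vi wi} → b * ui + a * vi ≡ D * wi → (a * inv D) * ((b * inv a) * ui + vi) ≡ wi
    rescale {b} {ui} {vi} {wi} e = begin
      (a * inv D) * ((b * inv a) * ui + vi)          ≡⟨ solve 6 (λ a ia iD b ui vi → (a :* iD) :* ((b :* ia) :* ui :+ vi) := iD :* (b :* ui :* (a :* ia) :+ a :* vi)) refl a (inv a) (inv D) b ui vi ⟩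
      inv D * (b * ui * (a * inv a) + a * vi)        ≡⟨ cong (λ z → inv D * (b * ui * z + a * vi)) (*-inverseʳ a a≢0) ⟩
      inv D * (b * ui * 1# + a * vi)                 ≡⟨ cong (λ z → inv D * (z + a * vi)) (*-identityʳ _) ⟩
      inv D * (b * ui + a * vi)                      ≡⟨ cong (inv D *_) e ⟩
      inv D * (D * wi)                               ≡⟨ solve 3 (λ iD D wi → iD :* (D :* wi) := (D :* iD) :* wi) refl (inv D) D wi ⟩
      (D * inv D) * wi                               ≡⟨ cong (_* wi) (*-inverseʳ D uv-basis) ⟩
      1# * wi                                        ≡⟨ *-identityˡ wi ⟩
      wi                                             ∎

  LineOf-affine⇒coord : ∀ α x → LineOf (affine α) x → coord x ≡ α
  LineOf-affine⇒coord α x (c , c≢0 , x≡c·) = begin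
    det (vec x) v * inv (det u (vec x))      ≡⟨ cong₂ (λ a b → a * inv b) det-x-v det-u-x ⟩
    ((c * D) * α) * inv (c * D)              ≡⟨ solve 3 (λ k a i → (k :* a) :* i := a :* (k :* i)) refl (c * D) α (inv (c * D)) ⟩
    α * ((c * D) * inv (c * D))              ≡⟨ cong (α *_) (*-inverseʳ (c * D) (*-≢0 c≢0 uv-basis)) ⟩
    α * 1#                                   ≡⟨ *-identityʳ α ⟩
    α                                        ∎
    where
    det-x-v : det (vec x) v ≡ (c * D) * α
    det-x-v = trans (cong (λ w → det w v) x≡c·)
      (solve 6 (λ c a u₁ u₂ v₁ v₂ → c :* (a :* u₁ :+ v₁) :* v₂ :- c :* (a :* u₂ :+ v₂) :* v₁ := (c :* (u₁ :* v₂ :- u₂ :* v₁)) :* a) refl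
        c α (proj₁ u) (proj₂ u) (proj₁ v) (proj₂ v))
    det-u-x : det u (vec x) ≡ c * D
    det-u-x = trans (cong (det u) x≡c·) (trans (det-·ʳ c u (affine α)) (cong (c *_) (det-u-affine α)))

  LineOf-affine⇒det≢0 : ∀ α x → LineOf (affine α) x → det u (vec x) ≢ 0#
  LineOf-affine⇒det≢0 α x (c , c≢0 , x≡c·) d≡0 = *-≢0 c≢0 uv-basis
    (trans (sym (trans (det-·ʳ c u (affine α)) (cong (c *_) (det-u-affine α)))) (trans (cong (det u) (sym x≡c·)) d≡0))

  coord-point : ∀ α → coord (point α) ≡ α
  coord-point α = LineOf-affine⇒coord α (point α) (LineOf-point α)

  det-u-point≢0 : ∀ α → det u (vec (point α)) ≢ 0#
  det-u-point≢0 α = LineOf-affine⇒det≢0 α (point α) (LineOf-point α)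

  point-injective : ∀ α β → point α ≈ point β → α ≡ β
  point-injective α β e = trans (sym (coord-point α))
    (trans (sym (LineOf-affine⇒coord (coord (point α)) (point β) (LineOf-resp-≈ _ (point α) (point β) (subst (λ γ → LineOf (affine γ) (point α)) (sym (coord-point α)) (LineOf-point α)) e)))
      (coord-point β))

  ≈point-coord : ∀ x → det u (vec x) ≢ 0# → x ≈ point (coord x)
  ≈point-coord x d≢0 = ≈-sym (point (coord x)) x (LineOf-coord x d≢0)

  coord-resp-≈ : ∀ {x y} → x ≈ y → det u (vec x) ≢ 0# → coord x ≡ coord y
  coord-resp-≈ {x} {y} x≈y d≢0 = sym (LineOf-affine⇒coord (coord x) y (LineOf-resp-≈ _ x y (LineOf-coord x d≢0) x≈y))

  coord-injective : ∀ x y → det u (vec x) ≢ 0# → det u (vec y) ≢ 0# → coord x ≡ coord y → x ≈ y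
  coord-injective x y dx≢0 dy≢0 e = ≈-trans x (point (coord x)) y (≈point-coord x dx≢0)
    (subst (λ a → point a ≈ y) (sym e) (≈-sym y (point (coord y)) (≈point-coord y dy≢0)))

  Γ⇒coords : ∀ {x y} → Γ u v x y → det u (vec x) ≢ 0# × det u (vec y) ≢ 0# × InC (coord x - coord y)
  Γ⇒coords {x} {y} (α , β , x∈ , y∈ , α-β∈C) = LineOf-affine⇒det≢0 α x x∈ , LineOf-affine⇒det≢0 β y y∈ ,
    subst InC (sym (cong₂ _-_ (LineOf-affine⇒coord α x x∈) (LineOf-affine⇒coord β y y∈))) α-β∈C

  coords⇒Γ : ∀ x y → det u (vec x) ≢ 0# → det u (vec y) ≢ 0# → InC (coord x - coord y) → Γ u v x y
  coords⇒Γ x y dx≢0 dy≢0 c = coord x , coord y , LineOf-coord x dx≢0 , LineOf-coord y dy≢0 , c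

  Γ-resp-≈ : ∀ {x x′ y y′} → Γ u v x y → x ≈ x′ → y ≈ y′ → Γ u v x′ y′
  Γ-resp-≈ {x} {x′} {y} {y′} (α , β , x∈ , y∈ , c) x≈x′ y≈y′ = α , β , LineOf-resp-≈ _ x x′ x∈ x≈x′ , LineOf-resp-≈ _ y y′ y∈ y≈y′ , c

  Γ-irreflexive : ∀ x y → Γ u v x y → ¬ x ≈ y
  Γ-irreflexive x y g x≈y =
    let (dx≢0 , _ , (α-β≢0 , _)) = Γ⇒coords {x} {y} g
    in α-β≢0 (trans (cong (_- coord y) (coord-resp-≈ {x} {y} x≈y dx≢0)) (-‿inverseʳ (coord y)))

  Q-affine : ∀ x y α β → LineOf (affine α) x → LineOf (affine β) y → Σ F λ k → k ≢ 0# × Q u v x y ≡ (α - β) * (k * k)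
  Q-affine x y α β (c , c≢0 , x≡c·) (d , d≢0 , y≡d·) = c * d * D * D , *-≢0 (*-≢0 (*-≢0 c≢0 d≢0) uv-basis) uv-basis ,
    trans (cong₂ (λ w w′ → D * det w w′ * det u w * det u w′) x≡c· y≡d·) (identity (proj₁ u) (proj₂ u) (proj₁ v) (proj₂ v) α β c d)
    where
    identity : ∀ u₁ u₂ v₁ v₂ α β c d →
      let D′ = u₁ * v₂ - u₂ * v₁
          x₁ = c * (α * u₁ + v₁) ; x₂ = c * (α * u₂ + v₂)
          y₁ = d * (β * u₁ + v₁) ; y₂ = d * (β * u₂ + v₂)
      in D′ * (x₁ * y₂ - x₂ * y₁) * (u₁ * x₂ - u₂ * x₁) * (u₁ * y₂ - u₂ * y₁) ≡ (α - β) * ((c * d * D′ * D′) * (c * d * D′ * D′))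
    identity = solve 8 (λ u₁ u₂ v₁ v₂ α β c d →
        let D′ = u₁ :* v₂ :- u₂ :* v₁
            x₁ = c :* (α :* u₁ :+ v₁) ; x₂ = c :* (α :* u₂ :+ v₂)
            y₁ = d :* (β :* u₁ :+ v₁) ; y₂ = d :* (β :* u₂ :+ v₂)
        in D′ :* (x₁ :* y₂ :- x₂ :* y₁) :* (u₁ :* x₂ :- u₂ :* x₁) :* (u₁ :* y₂ :- u₂ :* y₁) := (α :- β) :* ((c :* d :* D′ :* D′) :* (c :* d :* D′ :* D′))) refl

  Γ⇒Q∈C : ∀ x y → Γ u v x y → InC (Q u v x y)
  Γ⇒Q∈C x y (α , β , x∈ , y∈ , α-β∈C) =
    let (k , k≢0 , Q≡) = Q-affine x y α β x∈ y∈
    in subst InC (sym Q≡) (residue-*-square (α - β) k k≢0 α-β∈C)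

  ⇒Q≢0 : ∀ x y → det (vec x) (vec y) ≢ 0# → det u (vec x) ≢ 0# → det u (vec y) ≢ 0# → Q u v x y ≢ 0#
  ⇒Q≢0 x y xy≢0 ux≢0 uy≢0 = *-≢0 (*-≢0 (*-≢0 uv-basis xy≢0) ux≢0) uy≢0

  Q∈C⇒Γ : ∀ x y → InC (Q u v x y) → Γ u v x y
  Q∈C⇒Γ x y c =
    let (_ , ux≢0 , uy≢0) = Q≢0⇒ u v x y (proj₁ c)
        (k , k≢0 , Q≡) = Q-affine x y (coord x) (coord y) (LineOf-coord x ux≢0) (LineOf-coord y uy≢0)
    in coords⇒Γ x y ux≢0 uy≢0 (residue-/-square (coord x - coord y) k k≢0 (subst InC Q≡ c))

  Img-Γ : ∀ φ → Img φ (Γ u v) ≡G Γ (app φ u) (app φ v)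
  Img-Γ φ x y = forth , back
    where
    transport : ∀ α x (x′ : Point) → LineOf (affine α) x′ → LineOf (app φ (vec x′)) x → LineOf (α · app φ u ⊕ app φ v) x
    transport α x x′ (c , c≢0 , x′≡) (k , k≢0 , x≡) = k * c , *-≢0 k≢0 c≢0 ,
      trans x≡ (trans (cong (λ w → k · app φ w) x′≡)
        (trans (cong (k ·_) (trans (app-· φ c (affine α)) (cong (c ·_) (app-affine φ α u v)))) (·-assoc k c _)))
    forth : Img φ (Γ u v) x y → Γ (app φ u) (app φ v) x y
    forth (x′ , y′ , (α , β , x′∈ , y′∈ , α-β∈C) , x∈ , y∈) = α , β , transport α x x′ x′∈ x∈ , transport β y y′ y′∈ y∈ , α-β∈C
    back : Γ (app φ u) (app φ v) x y → Img φ (Γ u v) x y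
    back (α , β , (c , c≢0 , x≡) , (d , d≢0 , y≡) , α-β∈C) =
      point α , point β , (α , β , LineOf-point α , LineOf-point β , α-β∈C) ,
      (c , c≢0 , trans x≡ (cong (c ·_) (sym (app-affine φ α u v)))) , (d , d≢0 , trans y≡ (cong (d ·_) (sym (app-affine φ β u v))))

module PaleyGraph (t : ℕ) (K : FiniteField (4 ℕ.* t ℕ.+ 5)) (u v : FieldDefs.V K) (uv-basis : FieldDefs.Basis K u v) where
  open FieldDefs K
  open FieldBasics K
  open QuadraticResidues t K
  open ProjectiveLine K
  open AffineChart K u v uv-basis

  HasSize-# : (p : F → Bool) (P : Point → Set) → (∀ γ → p γ ≡ true → P (point γ)) →
              (∀ z → P z → det u (vec z) ≢ 0# × p (coord z) ≡ true) → HasSize P (# p)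
  HasSize-# p P p⇒P P⇒p = f , (λ i → p⇒P _ (proj₂ (select-∈ p elements (∈-lookup i)))) , f-injective , f-surjective
    where
    selected = select p elements
    f : Fin (length selected) → Point
    f i = point (lookup selected i)
    f-injective : ∀ i j → f i ≈ f j → i ≡ j
    f-injective i j e = lookup-injective (select-nodup p elements-nodup) i j (point-injective _ _ e)
    f-surjective : ∀ z → P z → Σ (Fin (length selected)) λ i → z ≈ f i
    f-surjective z Pz =
      let (uz≢0 , p-coord) = P⇒p z Pz
          (i , lookup≡) = index (∈-select p elements (∈-elements (coord z)) p-coord)
      in i , subst (λ a → z ≈ point a) (sym lookup≡) (≈point-coord z uz≢0)

  residue-coord-point : ∀ a γ → InC (a - γ) → InC (a - coord (point γ))
  residue-coord-point a γ = subst (λ b → InC (a - b)) (sym (coord-point γ))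

  neighbourhood-size : ∀ x → Xu u x → HasSize (λ z → Γ u v x z) (2 ℕ.* suc t)
  neighbourhood-size x x∈Xu = subst (HasSize (λ z → Γ u v x z)) (#neighbours (coord x))
    (HasSize-# (λ γ → isResidue (coord x - γ)) _
      (λ γ e → coords⇒Γ x (point γ) (Xu⇒det≢0 {x} x∈Xu) (det-u-point≢0 γ) (residue-coord-point (coord x) γ (isResidue⇒ e)))
      (λ z g → let (_ , uz≢0 , c) = Γ⇒coords {x} {z} g in uz≢0 , ⇒isResidue c))

  common-neighbourhood-size : ∀ x y → Xu u x → Xu u y →
    HasSize (λ z → Γ u v x z × Γ u v y z) (commonNeighbours (coord x) (coord y))
  common-neighbourhood-size x y x∈Xu y∈Xu = HasSize-# (λ γ → isResidue (coord x - γ) ∧ isResidue (coord y - γ)) _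
    (λ γ e → let (c₁ , c₂) = ∧-true⇒ {isResidue (coord x - γ)} e in
       coords⇒Γ x (point γ) (Xu⇒det≢0 {x} x∈Xu) (det-u-point≢0 γ) (residue-coord-point (coord x) γ (isResidue⇒ c₁)) ,
       coords⇒Γ y (point γ) (Xu⇒det≢0 {y} y∈Xu) (det-u-point≢0 γ) (residue-coord-point (coord y) γ (isResidue⇒ c₂)))
    (λ z (g₁ , g₂) → let (_ , uz≢0 , c₁) = Γ⇒coords {x} {z} g₁ ; (_ , _ , c₂) = Γ⇒coords {y} {z} g₂
                     in uz≢0 , ⇒∧-true (⇒isResidue c₁) (⇒isResidue c₂))

  Γ-sym : ∀ x y → Γ u v x y → Γ u v y x
  Γ-sym x y (α , β , x∈ , y∈ , α-β∈C) = β , α , y∈ , x∈ ,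
    subst InC (solve 2 (λ a b → :- (a :- b) := b :- a) refl α β) (residue-neg α-β∈C)

  coord-≢ : ∀ x y → Xu u x → coord x - coord y ≢ 0# → ¬ x ≈ y
  coord-≢ x y x∈Xu d≢0 x≈y = d≢0 (trans (cong (_- coord y) (coord-resp-≈ {x} {y} x≈y (Xu⇒det≢0 {x} x∈Xu))) (-‿inverseʳ (coord y)))

  dist-nonresidue : ∀ x y → Xu u x → Xu u y → isNonResidue (coord x - coord y) ≡ true → Dist (Γ u v) x y 2
  dist-nonresidue x y x∈Xu y∈Xu n = walk , shorter
    where
    x≉y = coord-≢ x y x∈Xu (proj₁ (isNonResidue⇒ n))
    shorter : ∀ m → m ℕ.< 2 → ¬ Walk (Γ u v) x y m
    shorter zero _ (here x≈y) = x≉y x≈y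
    shorter (suc zero) _ (step {z = z} g (here z≈y)) = true≢false (trans
      (sym (⇒isResidue (proj₂ (proj₂ (Γ⇒coords {x} {y} (Γ-resp-≈ {x} {x} {z} {y} g (≈-refl x) z≈y))))))
      (nonresidue⇒¬residue {coord x - coord y} n))
    shorter (suc (suc m)) (s≤s (s≤s ()))
    γ = proj₁ (#≢0⇒ (λ γ → isResidue (coord x - γ) ∧ isResidue (coord y - γ)) t (commonNeighbours-nonresidue (coord x) (coord y) n))
    γ-common = ∧-true⇒ {isResidue (coord x - γ)} (proj₂ (#≢0⇒ _ t (commonNeighbours-nonresidue (coord x) (coord y) n)))
    x~γ : Γ u v x (point γ)
    x~γ = coords⇒Γ x (point γ) (Xu⇒det≢0 {x} x∈Xu) (det-u-point≢0 γ) (residue-coord-point (coord x) γ (isResidue⇒ (proj₁ γ-common)))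
    y~γ : Γ u v y (point γ)
    y~γ = coords⇒Γ y (point γ) (Xu⇒det≢0 {y} y∈Xu) (det-u-point≢0 γ) (residue-coord-point (coord y) γ (isResidue⇒ (proj₂ γ-common)))
    walk = step {z = point γ} x~γ (step {z = y} (Γ-sym y (point γ) y~γ) (here (≈-refl y)))

  diameter : Diameter (Γ u v) (Xu u) 2
  diameter = at-most-2 , attained
    where
    at-most-2 : ∀ x y → Xu u x → Xu u y → Σ ℕ λ e → e ℕ.≤ 2 × Dist (Γ u v) x y e
    at-most-2 x y x∈Xu y∈Xu with trichotomy (coord x - coord y)
    ... | zero d≡0 = 0 , z≤n , here (coord-injective x y (Xu⇒det≢0 {x} x∈Xu) (Xu⇒det≢0 {y} y∈Xu) (x-y≡0⇒x≡y _ _ d≡0)) , λ _ ()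
    ... | residue c _ = 1 , s≤s z≤n ,
          step {z = y} (coords⇒Γ x y (Xu⇒det≢0 {x} x∈Xu) (Xu⇒det≢0 {y} y∈Xu) (isResidue⇒ c)) (here (≈-refl y)) ,
          λ { zero _ (here x≈y) → coord-≢ x y x∈Xu (proj₁ (isResidue⇒ c)) x≈y ; (suc m) (s≤s ()) }
    ... | nonresidue _ n = 2 , s≤s (s≤s z≤n) , dist-nonresidue x y x∈Xu y∈Xu n
    attained : Σ Point λ x → Σ Point λ y → Xu u x × Xu u y × Dist (Γ u v) x y 2
    attained =
      let (n , n∈N) = #≢0⇒ isNonResidue (t ℕ.+ (suc t ℕ.+ 0)) #nonresidues
      in point 0# , point n , det≢0⇒Xu {point 0#} (det-u-point≢0 0#) , det≢0⇒Xu {point n} (det-u-point≢0 n) ,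
         dist-nonresidue (point 0#) (point n) (det≢0⇒Xu {point 0#} (det-u-point≢0 0#)) (det≢0⇒Xu {point n} (det-u-point≢0 n))
           (trans (cong₂ (λ a b → isNonResidue (a - b)) (coord-point 0#) (coord-point n))
             (trans (cong isNonResidue (+-identityˡ (- n))) (trans (proj₂ (isResidue-neg n)) n∈N)))

  distance-2 : ∀ x y → Xu u x → Xu u y → Dist (Γ u v) x y 2 → isNonResidue (coord x - coord y) ≡ true
  distance-2 x y x∈Xu y∈Xu (_ , shorter) with trichotomy (coord x - coord y)
  ... | zero d≡0 = ⊥-elim (shorter 0 (s≤s z≤n) (here (coord-injective x y (Xu⇒det≢0 {x} x∈Xu) (Xu⇒det≢0 {y} y∈Xu) (x-y≡0⇒x≡y _ _ d≡0))))
  ... | residue c _ = ⊥-elim (shorter 1 (s≤s (s≤s z≤n))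
          (step {z = y} (coords⇒Γ x y (Xu⇒det≢0 {x} x∈Xu) (Xu⇒det≢0 {y} y∈Xu) (isResidue⇒ c)) (here (≈-refl y))))
  ... | nonresidue _ n = n

  strongly-regular :
      Diameter (Γ u v) (Xu u) 2
    × (∀ x → Xu u x → HasSize (λ z → Γ u v x z) (2 ℕ.* suc t))
    × (∀ x y → Xu u x → Xu u y → Γ u v x y → HasSize (λ z → Γ u v x z × Γ u v y z) t)
    × (∀ x y → Xu u x → Xu u y → Dist (Γ u v) x y 2 → HasSize (λ z → Γ u v x z × Γ u v y z) (suc t))
  strongly-regular = diameter , neighbourhood-size ,
    (λ x y x∈Xu y∈Xu g → subst (HasSize _) (commonNeighbours-residue (coord x) (coord y) (proj₂ (proj₂ (Γ⇒coords {x} {y} g))))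
                           (common-neighbourhood-size x y x∈Xu y∈Xu)) ,
    (λ x y x∈Xu y∈Xu d → subst (HasSize _) (commonNeighbours-nonresidue (coord x) (coord y) (distance-2 x y x∈Xu y∈Xu d))
                           (common-neighbourhood-size x y x∈Xu y∈Xu))

module Stabilizer (t : ℕ) (K : FiniteField (4 ℕ.* t ℕ.+ 5)) (u v : FieldDefs.V K) (uv-basis : FieldDefs.Basis K u v) where
  open FieldDefs K
  open FieldBasics K
  open QuadraticResidues t K
  open ProjectiveLine K
  open AffineChart K u v uv-basis

  Q-stabilizer : ∀ φ c → app φ u ≡ c · u → ∀ x y → Q (app φ u) (app φ v) x y ≡ Q u v x y * (detM φ * (c * c))
  Q-stabilizer φ c φu≡cu x y = begin
    det (app φ u) (app φ v) * e * det (app φ u) (vec x) * det (app φ u) (vec y)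
      ≡⟨ cong₂ (λ a b → det (app φ u) (app φ v) * e * a * b) (det-φu (vec x)) (det-φu (vec y)) ⟩
    det (app φ u) (app φ v) * e * (c * a) * (c * b)
      ≡⟨ cong (λ z → z * e * (c * a) * (c * b)) (det-app φ u v) ⟩
    (detM φ * D) * e * (c * a) * (c * b)
      ≡⟨ solve 6 (λ m D e c a b → (m :* D) :* e :* (c :* a) :* (c :* b) := (D :* e :* a :* b) :* (m :* (c :* c))) refl (detM φ) D e c a b ⟩
    Q u v x y * (detM φ * (c * c))  ∎
    where
    open ≡-Reasoning
    e = det (vec x) (vec y)
    a = det u (vec x)
    b = det u (vec y)
    det-φu : ∀ w → det (app φ u) w ≡ c * det u w
    det-φu w = trans (cong (λ z → det z w) φu≡cu) (det-·ˡ c u w)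

  Γ-stabilizer : ∀ φ → detM φ ≢ 0# → Stabilizes φ u →
      (IsSquare (detM φ) → Γ (app φ u) (app φ v) ≡G Γ u v)
    × (¬ IsSquare (detM φ) → Γ (app φ u) (app φ v) ≡G Complement (Xu u) (Γ u v))
  Γ-stabilizer φ detφ≢0 (c , c≢0 , φu≡cu) = square , nonsquare
    where
    φuv-basis : Basis (app φ u) (app φ v)
    φuv-basis e = *-≢0 detφ≢0 uv-basis (trans (sym (det-app φ u v)) e)
    module Image = AffineChart K (app φ u) (app φ v) φuv-basis
    M = detM φ * (c * c)
    c²∈C : InC (c * c)
    c²∈C = subst InC (*-identityˡ _) (residue-*-square 1# c c≢0 (isResidue⇒ isResidue-1))

    square : IsSquare (detM φ) → Γ (app φ u) (app φ v) ≡G Γ u v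
    square sq x y = (λ g → Q∈C⇒Γ x y (isResidue⇒ (trans (sym same-class) (⇒isResidue (Image.Γ⇒Q∈C x y g))))) ,
                    (λ g → Image.Q∈C⇒Γ x y (isResidue⇒ (trans same-class (⇒isResidue (Γ⇒Q∈C x y g)))))
      where
      same-class : isResidue (Q (app φ u) (app φ v) x y) ≡ isResidue (Q u v x y)
      same-class = trans (cong isResidue (Q-stabilizer φ c φu≡cu x y))
                     (proj₁ (isResidue-*-residue (residue-* (detφ≢0 , sq) c²∈C) (Q u v x y)))

    nonsquare : ¬ IsSquare (detM φ) → Γ (app φ u) (app φ v) ≡G Complement (Xu u) (Γ u v)
    nonsquare ¬sq x y = forth , back
      where
      M∈N : isNonResidue M ≡ true
      M∈N = nonresidue-*-residue (⇒isNonResidue detφ≢0 ¬sq) c²∈C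
      opposite-class : isResidue (Q (app φ u) (app φ v) x y) ≡ isNonResidue (Q u v x y)
      opposite-class = trans (cong isResidue (Q-stabilizer φ c φu≡cu x y)) (proj₁ (isResidue-*-nonresidue M∈N (Q u v x y)))
      forth : Γ (app φ u) (app φ v) x y → Complement (Xu u) (Γ u v) x y
      forth g =
        let Q∈N = trans (sym opposite-class) (⇒isResidue (Image.Γ⇒Q∈C x y g))
            (xy≢0 , ux≢0 , uy≢0) = Q≢0⇒ u v x y (proj₁ (isNonResidue⇒ Q∈N))
        in det≢0⇒Xu {x} ux≢0 , det≢0⇒Xu {y} uy≢0 , (λ x≈y → xy≢0 (≈⇒det≡0 {x} {y} x≈y)) ,
           (λ g′ → true≢false (trans (sym (⇒isResidue (Γ⇒Q∈C x y g′))) (nonresidue⇒¬residue Q∈N)))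
      back : Complement (Xu u) (Γ u v) x y → Γ (app φ u) (app φ v) x y
      back (x∈Xu , y∈Xu , x≉y , ¬g) = Image.Q∈C⇒Γ x y (isResidue⇒ (trans opposite-class Q∈N))
        where
        Q∈N : isNonResidue (Q u v x y) ≡ true
        Q∈N with trichotomy (Q u v x y)
        ... | zero Q≡0 = ⊥-elim (⇒Q≢0 x y (λ d≡0 → x≉y (det≡0⇒≈ x y d≡0)) (Xu⇒det≢0 {x} x∈Xu) (Xu⇒det≢0 {y} y∈Xu) Q≡0)
        ... | residue Q∈C _ = ⊥-elim (¬g (Q∈C⇒Γ x y (isResidue⇒ Q∈C)))
        ... | nonresidue _ Q∈N = Q∈N

opposite-*ʳ : ∀ p q → opposite (p Sign.* q) ≡ p Sign.* opposite q
opposite-*ʳ Sign.+ q = refl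
opposite-*ʳ Sign.- Sign.+ = refl
opposite-*ʳ Sign.- Sign.- = refl

*-self-cancelˡ : ∀ p q → p Sign.* p Sign.* q ≡ q
*-self-cancelˡ p q = cong (Sign._* q) (Sign.s*s≡+ p)

*≡+⇒≡ : ∀ p q → p Sign.* q ≡ Sign.+ → p ≡ q
*≡+⇒≡ Sign.+ Sign.+ _ = refl
*≡+⇒≡ Sign.- Sign.- _ = refl

module Signs (t : ℕ) (K : FiniteField (4 ℕ.* t ℕ.+ 5)) where
  open FieldDefs K
  open FieldBasics K
  open QuadraticResidues t K
  open ProjectiveLine K

  χ-residue : ∀ {X} → InC X → χ X ≡ Sign.+
  χ-residue c = cong (if_then Sign.+ else Sign.-) (⇒isResidue c)

  χ-0 : χ 0# ≡ Sign.-
  χ-0 = cong (if_then Sign.+ else Sign.-) isResidue-0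

  χ-*-square : ∀ X c → c ≢ 0# → χ (X * (c * c)) ≡ χ X
  χ-*-square X c c≢0 = cong (if_then Sign.+ else Sign.-) (isResidue-*-square X c c≢0)

  χ-neg : ∀ X → χ (- X) ≡ χ X
  χ-neg X = cong (if_then Sign.+ else Sign.-) (proj₁ (isResidue-neg X))

  χ-ratio : ∀ X Z → X ≢ 0# → Z ≢ 0# → InC (X * Z) → χ X ≡ χ Z
  χ-ratio X Z X≢0 Z≢0 XZ∈C = *≡+⇒≡ (χ X) (χ Z) (trans (sym (χ-* X Z X≢0 Z≢0)) (χ-residue XZ∈C))

  -- The entry ε_{x,y} of the matrix of Γ u v: it is - exactly when Q u v x y is a residue.
  ε : V → V → Point → Point → Sign
  ε u v x y = opposite (χ (Q u v x y))

  ε-zero : ∀ u v x y → Q u v x y ≡ 0# → ε u v x y ≡ Sign.+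
  ε-zero u v x y Q≡0 = cong opposite (trans (cong χ Q≡0) χ-0)

  ε-sym : ∀ u v x y → ε u v y x ≡ ε u v x y
  ε-sym u v x y = cong opposite (trans (cong χ (Q-antisym u v x y)) (χ-neg _))

  module _ (u v : V) (uv-basis : Basis u v) where
    open AffineChart K u v uv-basis

    Eps-Γ-ε : ∀ x y → Eps (Γ u v) x y (ε u v x y)
    Eps-Γ-ε x y = by-class (isResidue (Q u v x y)) refl
      where
      by-class : ∀ b → isResidue (Q u v x y) ≡ b → Eps (Γ u v) x y (ε u v x y)
      by-class true Q∈C = let g = Q∈C⇒Γ x y (isResidue⇒ Q∈C) in
        inj₁ (cong (λ b → opposite (if b then Sign.+ else Sign.-)) Q∈C , Γ-irreflexive x y g , g)
      by-class false Q∉C =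
        inj₂ (cong (λ b → opposite (if b then Sign.+ else Sign.-)) Q∉C , λ (_ , g) → true≢false (trans (sym (⇒isResidue (Γ⇒Q∈C x y g))) Q∉C))

    Eps-Γ⇒ε : ∀ x y σ → Eps (Γ u v) x y σ → σ ≡ ε u v x y
    Eps-Γ⇒ε x y σ (inj₁ (refl , (_ , g))) = sym (cong opposite (χ-residue (Γ⇒Q∈C x y g)))
    Eps-Γ⇒ε x y σ (inj₂ (refl , ¬adj)) = by-class (isResidue (Q u v x y)) refl
      where
      by-class : ∀ b → isResidue (Q u v x y) ≡ b → Sign.+ ≡ ε u v x y
      by-class true Q∈C = let g = Q∈C⇒Γ x y (isResidue⇒ Q∈C) in ⊥-elim (¬adj (Γ-irreflexive x y g , g))
      by-class false Q∉C = sym (cong (λ b → opposite (if b then Sign.+ else Sign.-)) Q∉C)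

-- Γ u′ v′ is obtained from Γ u v by switching with ν whenever det(u,v) det(u′,v′) is a residue.
module Switch (t : ℕ) (K : FiniteField (4 ℕ.* t ℕ.+ 5))
              (u v : FieldDefs.V K) (uv-basis : FieldDefs.Basis K u v)
              (u′ v′ : FieldDefs.V K) (u′v′-basis : FieldDefs.Basis K u′ v′)
              (DD′∈C : FieldDefs.InC K (FiniteField._*_ K (FieldDefs.det K u v) (FieldDefs.det K u′ v′))) where
  open FieldDefs K
  open FieldBasics K
  open QuadraticResidues t K
  open ProjectiveLine K
  open Signs t K
  open ≡-Reasoning

  D D′ k k′ : F
  D = det u v
  D′ = det u′ v′
  k = det u u′
  k′ = det u′ u

  u≢0 : u ≢ 0V
  u≢0 = det≢0⇒≢0ˡ u v uv-basis

  u′≢0 : u′ ≢ 0V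
  u′≢0 = det≢0⇒≢0ˡ u′ v′ u′v′-basis

  k≢0⇒k′≢0 : k ≢ 0# → k′ ≢ 0#
  k≢0⇒k′≢0 = det-swap-≢0 u u′

  -- Off the lines ⟨u⟩, ⟨u′⟩ the switching is χ(det(u,x) det(u′,x)); its values on the two lines are forced.
  ν-by : Bool → Bool → Bool → V → Sign
  ν-by true _ _ _ = Sign.+
  ν-by false true _ _ = opposite (χ (D′ * k′))
  ν-by false false true _ = opposite (χ (D * k))
  ν-by false false false w = χ (det u w * det u′ w)

  ν : Point → Sign
  ν x = ν-by (isZero k) (isZero (det u (vec x))) (isZero (det u′ (vec x))) (vec x)

  ν-k≡0 : k ≡ 0# → ∀ x → ν x ≡ Sign.+
  ν-k≡0 k≡0 x = cong (λ b → ν-by b (isZero (det u (vec x))) (isZero (det u′ (vec x))) (vec x)) (⇒isZero k≡0)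

  ν-on-u : k ≢ 0# → ∀ x → det u (vec x) ≡ 0# → ν x ≡ opposite (χ (D′ * k′))
  ν-on-u k≢0 x ux≡0 = cong₂ (λ b c → ν-by b c (isZero (det u′ (vec x))) (vec x)) (⇒¬isZero k≢0) (⇒isZero ux≡0)

  ν-on-u′ : k ≢ 0# → ∀ x → det u (vec x) ≢ 0# → det u′ (vec x) ≡ 0# → ν x ≡ opposite (χ (D * k))
  ν-on-u′ k≢0 x ux≢0 u′x≡0 rewrite ⇒¬isZero k≢0 | ⇒¬isZero ux≢0 | ⇒isZero u′x≡0 = refl

  ν-off : k ≢ 0# → ∀ x → det u (vec x) ≢ 0# → det u′ (vec x) ≢ 0# → ν x ≡ χ (det u (vec x) * det u′ (vec x))
  ν-off k≢0 x ux≢0 u′x≢0 rewrite ⇒¬isZero k≢0 | ⇒¬isZero ux≢0 | ⇒¬isZero u′x≢0 = refl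

  data Position (w : V) : Set where
    on-u  : det u w ≡ 0# → Position w
    on-u′ : det u w ≢ 0# → det u′ w ≡ 0# → Position w
    off   : det u w ≢ 0# → det u′ w ≢ 0# → Position w

  position : ∀ w → Position w
  position w with det u w ≟ 0# | det u′ w ≟ 0#
  ... | yes uw≡0 | _ = on-u uw≡0
  ... | no uw≢0 | yes u′w≡0 = on-u′ uw≢0 u′w≡0
  ... | no uw≢0 | no u′w≢0 = off uw≢0 u′w≢0

  ν-resp-≈ : ∀ x y → x ≈ y → ν x ≡ ν y
  ν-resp-≈ x y (c , c≢0 , y≡cx) = by-cases (k ≟ 0#)
    where
    det-y : ∀ z → det z (vec y) ≡ c * det z (vec x)
    det-y z = trans (cong (det z) y≡cx) (det-·ʳ c z (vec x))
    scaled-≢0 : ∀ z → det z (vec x) ≢ 0# → det z (vec y) ≢ 0#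
    scaled-≢0 z zx≢0 e = *-≢0 c≢0 zx≢0 (trans (sym (det-y z)) e)
    scaled-≡0 : ∀ z → det z (vec x) ≡ 0# → det z (vec y) ≡ 0#
    scaled-≡0 z zx≡0 = trans (det-y z) (trans (cong (c *_) zx≡0) (zeroʳ c))
    by-position : k ≢ 0# → Position (vec x) → ν x ≡ ν y
    by-position k≢0 (on-u ux≡0) = trans (ν-on-u k≢0 x ux≡0) (sym (ν-on-u k≢0 y (scaled-≡0 u ux≡0)))
    by-position k≢0 (on-u′ ux≢0 u′x≡0) = trans (ν-on-u′ k≢0 x ux≢0 u′x≡0) (sym (ν-on-u′ k≢0 y (scaled-≢0 u ux≢0) (scaled-≡0 u′ u′x≡0)))
    by-position k≢0 (off ux≢0 u′x≢0) = trans (ν-off k≢0 x ux≢0 u′x≢0) (sym (begin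
      ν y                                        ≡⟨ ν-off k≢0 y (scaled-≢0 u ux≢0) (scaled-≢0 u′ u′x≢0) ⟩
      χ (det u (vec y) * det u′ (vec y))         ≡⟨ cong₂ (λ p q → χ (p * q)) (det-y u) (det-y u′) ⟩
      χ ((c * det u (vec x)) * (c * det u′ (vec x)))
        ≡⟨ cong χ (solve 3 (λ c a b → (c :* a) :* (c :* b) := (a :* b) :* (c :* c)) refl c (det u (vec x)) (det u′ (vec x))) ⟩
      χ ((det u (vec x) * det u′ (vec x)) * (c * c)) ≡⟨ χ-*-square _ c c≢0 ⟩
      χ (det u (vec x) * det u′ (vec x))         ∎))
    by-cases : Dec (k ≡ 0#) → ν x ≡ ν y
    by-cases (yes k≡0) = trans (ν-k≡0 k≡0 x) (sym (ν-k≡0 k≡0 y))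
    by-cases (no k≢0) = by-position k≢0 (position (vec x))

  Switches : Point → Point → Set
  Switches i j = ε u′ v′ i j ≡ ν i Sign.* ν j Sign.* ε u v i j

  switches-≈ : ∀ i j → det (vec i) (vec j) ≡ 0# → Switches i j
  switches-≈ i j ij≡0 = begin
    ε u′ v′ i j                          ≡⟨ ε-zero u′ v′ i j (Q-≈-zero u′ v′ {i} {j} ij≡0) ⟩
    Sign.+                               ≡⟨ *-self-cancelˡ (ν i) Sign.+ ⟨
    ν i Sign.* ν i Sign.* Sign.+         ≡⟨ cong₂ (λ p q → ν i Sign.* p Sign.* q) (ν-resp-≈ i j (det≡0⇒≈ i j ij≡0))
                                                (sym (ε-zero u v i j (Q-≈-zero u v {i} {j} ij≡0))) ⟩
    ν i Sign.* ν j Sign.* ε u v i j      ∎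

  switches-k≡0 : k ≡ 0# → ∀ i j → Switches i j
  switches-k≡0 k≡0 i j = trans (cong opposite (by-cases (Q u v i j ≟ 0#)))
    (sym (cong₂ (λ p q → p Sign.* q Sign.* ε u v i j) (ν-k≡0 k≡0 i) (ν-k≡0 k≡0 j)))
    where
    κ-parallel = det≡0⇒parallel u u′ u≢0 u′≢0 k≡0
    κ = proj₁ κ-parallel
    κ≢0 = proj₁ (proj₂ κ-parallel)
    e = det (vec i) (vec j)
    a = det u (vec i)
    b = det u (vec j)
    Q′≡ : Q u′ v′ i j ≡ D′ * e * (κ * a) * (κ * b)
    Q′≡ = cong₂ (λ p q → D′ * e * p * q)
      (trans (cong (λ z → det z (vec i)) (proj₂ (proj₂ κ-parallel))) (det-·ˡ κ u (vec i)))
      (trans (cong (λ z → det z (vec j)) (proj₂ (proj₂ κ-parallel))) (det-·ˡ κ u (vec j)))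
    Q′D≡QD′κ² : Q u′ v′ i j * D ≡ Q u v i j * (D′ * κ * κ)
    Q′D≡QD′κ² = trans (cong (_* D) Q′≡)
      (solve 6 (λ D D′ e k a b → D′ :* e :* (k :* a) :* (k :* b) :* D := (D :* e :* a :* b) :* (D′ :* k :* k)) refl D D′ e κ a b)
    by-cases : Dec (Q u v i j ≡ 0#) → χ (Q u′ v′ i j) ≡ χ (Q u v i j)
    by-cases (yes Q≡0) = cong χ (trans Q′≡0 (sym Q≡0))
      where
      Q′≡0 : Q u′ v′ i j ≡ 0#
      Q′≡0 = [ (λ Q′≡0 → Q′≡0) , (λ D≡0 → ⊥-elim (uv-basis D≡0)) ]′
               (zero-product _ _ (trans Q′D≡QD′κ² (trans (cong (_* (D′ * κ * κ)) Q≡0) (zeroˡ _))))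
    by-cases (no Q≢0) = χ-ratio _ _ Q′≢0 Q≢0 (subst InC (sym Q′Q≡) (residue-*-square (D * D′) (κ * e * a * b) T≢0 DD′∈C))
      where
      Q′≢0 : Q u′ v′ i j ≢ 0#
      Q′≢0 Q′≡0 = *-≢0 Q≢0 (*-≢0 (*-≢0 u′v′-basis κ≢0) κ≢0) (trans (sym Q′D≡QD′κ²) (trans (cong (_* D) Q′≡0) (zeroˡ _)))
      nonzero = Q≢0⇒ u v i j Q≢0
      T≢0 : κ * e * a * b ≢ 0#
      T≢0 = *-≢0 (*-≢0 (*-≢0 κ≢0 (proj₁ nonzero)) (proj₁ (proj₂ nonzero))) (proj₂ (proj₂ nonzero))
      Q′Q≡ : Q u′ v′ i j * Q u v i j ≡ (D * D′) * ((κ * e * a * b) * (κ * e * a * b))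
      Q′Q≡ = trans (cong (_* Q u v i j) Q′≡)
        (solve 6 (λ D D′ e k a b → D′ :* e :* (k :* a) :* (k :* b) :* (D :* e :* a :* b) := (D :* D′) :* ((k :* e :* a :* b) :* (k :* e :* a :* b))) refl D D′ e κ a b)

  switches-off-off : k ≢ 0# → ∀ i j → det (vec i) (vec j) ≢ 0# →
    det u (vec i) ≢ 0# → det u′ (vec i) ≢ 0# → det u (vec j) ≢ 0# → det u′ (vec j) ≢ 0# → Switches i j
  switches-off-off k≢0 i j e≢0 a≢0 a′≢0 b≢0 b′≢0 = begin
    opposite (χ (Q u′ v′ i j))                         ≡⟨ cong opposite (χ-ratio _ _ Q′≢0 (*-≢0 Y≢0 Q≢0) (subst InC (sym Q′YQ≡) (residue-*-square (D * D′) T T≢0 DD′∈C))) ⟩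
    opposite (χ (Y * Q u v i j))                       ≡⟨ cong opposite (trans (χ-* Y _ Y≢0 Q≢0) (cong (Sign._* χ (Q u v i j)) (χ-* (a * a′) (b * b′) (*-≢0 a≢0 a′≢0) (*-≢0 b≢0 b′≢0)))) ⟩
    opposite (χ (a * a′) Sign.* χ (b * b′) Sign.* χ (Q u v i j)) ≡⟨ opposite-*ʳ (χ (a * a′) Sign.* χ (b * b′)) _ ⟩
    χ (a * a′) Sign.* χ (b * b′) Sign.* ε u v i j       ≡⟨ cong₂ (λ p q → p Sign.* q Sign.* ε u v i j) (ν-off k≢0 i a≢0 a′≢0) (ν-off k≢0 j b≢0 b′≢0) ⟨
    ν i Sign.* ν j Sign.* ε u v i j                    ∎
    where
    e = det (vec i) (vec j)
    a = det u (vec i)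
    b = det u (vec j)
    a′ = det u′ (vec i)
    b′ = det u′ (vec j)
    Y = (a * a′) * (b * b′)
    T = e * a * a′ * b * b′
    Y≢0 : Y ≢ 0#
    Y≢0 = *-≢0 (*-≢0 a≢0 a′≢0) (*-≢0 b≢0 b′≢0)
    Q≢0 = AffineChart.⇒Q≢0 K u v uv-basis i j e≢0 a≢0 b≢0
    Q′≢0 = AffineChart.⇒Q≢0 K u′ v′ u′v′-basis i j e≢0 a′≢0 b′≢0
    T≢0 : T ≢ 0#
    T≢0 = *-≢0 (*-≢0 (*-≢0 (*-≢0 e≢0 a≢0) a′≢0) b≢0) b′≢0
    Q′YQ≡ : Q u′ v′ i j * (Y * Q u v i j) ≡ (D * D′) * (T * T)
    Q′YQ≡ = solve 7 (λ D D′ e a b a′ b′ → (D′ :* e :* a′ :* b′) :* (((a :* a′) :* (b :* b′)) :* (D :* e :* a :* b))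
                                       := (D :* D′) :* ((e :* a :* a′ :* b :* b′) :* (e :* a :* a′ :* b :* b′))) refl D D′ e a b a′ b′

  switches-u-off : k ≢ 0# → ∀ i j → det u (vec i) ≡ 0# → det u (vec j) ≢ 0# → det u′ (vec j) ≢ 0# → Switches i j
  switches-u-off k≢0 i j ui≡0 b≢0 b′≢0 = begin
    opposite (χ (Q u′ v′ i j))                        ≡⟨ cong opposite (trans (cong χ Q′≡) (trans (χ-*-square _ c c≢0) (χ-* (D′ * k′) (b * b′) (*-≢0 u′v′-basis (k≢0⇒k′≢0 k≢0)) (*-≢0 b≢0 b′≢0)))) ⟩
    opposite (χ (D′ * k′) Sign.* χ (b * b′))          ≡⟨ on-u-identity (χ (D′ * k′)) (χ (b * b′)) ⟩
    opposite (χ (D′ * k′)) Sign.* χ (b * b′) Sign.* Sign.+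
      ≡⟨ cong₃ (ν-on-u k≢0 i ui≡0) (ν-off k≢0 j b≢0 b′≢0) (ε-zero u v i j (Q-zeroˡ u v {i} j ui≡0)) ⟨
    ν i Sign.* ν j Sign.* ε u v i j                   ∎
    where
    b = det u (vec j)
    b′ = det u′ (vec j)
    i∥u = det≡0⇒parallel u (vec i) u≢0 (proj₂ i) ui≡0
    c = proj₁ i∥u
    c≢0 = proj₁ (proj₂ i∥u)
    Q′≡ : Q u′ v′ i j ≡ (D′ * k′ * (b * b′)) * (c * c)
    Q′≡ = trans (cong₂ (λ p q → D′ * p * q * b′)
                  (trans (cong (λ z → det z (vec j)) (proj₂ (proj₂ i∥u))) (det-·ˡ c u (vec j)))
                  (trans (cong (det u′) (proj₂ (proj₂ i∥u))) (det-·ʳ c u′ u)))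
            (solve 5 (λ D′ c b k′ b′ → D′ :* (c :* b) :* (c :* k′) :* b′ := (D′ :* k′ :* (b :* b′)) :* (c :* c)) refl D′ c b k′ b′)
    on-u-identity : ∀ p q → opposite (p Sign.* q) ≡ opposite p Sign.* q Sign.* Sign.+
    on-u-identity p q = trans (cong opposite (Sign.*-comm p q)) (trans (opposite-*ʳ q p) (trans (Sign.*-comm q (opposite p)) (sym (Sign.*-identityʳ _))))
    cong₃ : ∀ {p p′ q q′ r r′} → p ≡ p′ → q ≡ q′ → r ≡ r′ → p Sign.* q Sign.* r ≡ p′ Sign.* q′ Sign.* r′
    cong₃ refl refl refl = refl

  switches-u′-off : k ≢ 0# → ∀ i j → det u (vec i) ≢ 0# → det u′ (vec i) ≡ 0# → det u (vec j) ≢ 0# → det u′ (vec j) ≢ 0# → Switches i j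
  switches-u′-off k≢0 i j ui≢0 u′i≡0 b≢0 b′≢0 = begin
    ε u′ v′ i j                                        ≡⟨ ε-zero u′ v′ i j (Q-zeroˡ u′ v′ {i} j u′i≡0) ⟩
    Sign.+                                             ≡⟨ on-u′-identity (χ (D * k)) (χ (b * b′)) ⟩
    opposite (χ (D * k)) Sign.* χ (b * b′) Sign.* opposite (χ (D * k) Sign.* χ (b * b′))
      ≡⟨ cong₂ (λ p q → p Sign.* q Sign.* opposite (χ (D * k) Sign.* χ (b * b′))) (ν-on-u′ k≢0 i ui≢0 u′i≡0) (ν-off k≢0 j b≢0 b′≢0) ⟨
    ν i Sign.* ν j Sign.* opposite (χ (D * k) Sign.* χ (b * b′))   ≡⟨ cong (λ s → ν i Sign.* ν j Sign.* opposite s) χQ≡ ⟨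
    ν i Sign.* ν j Sign.* ε u v i j                    ∎
    where
    b = det u (vec j)
    b′ = det u′ (vec j)
    i∥u′ = det≡0⇒parallel u′ (vec i) u′≢0 (proj₂ i) u′i≡0
    c = proj₁ i∥u′
    c≢0 = proj₁ (proj₂ i∥u′)
    Q≡ : Q u v i j ≡ (D * k * (b * b′)) * (c * c)
    Q≡ = trans (cong₂ (λ p q → D * p * q * b)
                 (trans (cong (λ z → det z (vec j)) (proj₂ (proj₂ i∥u′))) (det-·ˡ c u′ (vec j)))
                 (trans (cong (det u) (proj₂ (proj₂ i∥u′))) (det-·ʳ c u u′)))
           (solve 5 (λ D c b′ k b → D :* (c :* b′) :* (c :* k) :* b := (D :* k :* (b :* b′)) :* (c :* c)) refl D c b′ k b)
    χQ≡ : χ (Q u v i j) ≡ χ (D * k) Sign.* χ (b * b′)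
    χQ≡ = trans (cong χ Q≡) (trans (χ-*-square _ c c≢0) (χ-* (D * k) (b * b′) (*-≢0 uv-basis k≢0) (*-≢0 b≢0 b′≢0)))
    on-u′-identity : ∀ p q → Sign.+ ≡ opposite p Sign.* q Sign.* opposite (p Sign.* q)
    on-u′-identity Sign.+ Sign.+ = refl
    on-u′-identity Sign.+ Sign.- = refl
    on-u′-identity Sign.- Sign.+ = refl
    on-u′-identity Sign.- Sign.- = refl

  -- D k′ · D′ k = -D D′ k² is a residue because -1 is, so the two forced values of ν agree.
  switches-u-u′ : k ≢ 0# → ∀ i j → det u (vec i) ≡ 0# → det u (vec j) ≢ 0# → det u′ (vec j) ≡ 0# → Switches i j
  switches-u-u′ k≢0 i j ui≡0 uj≢0 u′j≡0 = begin
    ε u′ v′ i j                                          ≡⟨ ε-zero u′ v′ i j (Q-zeroʳ u′ v′ i {j} u′j≡0) ⟩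
    Sign.+                                               ≡⟨ Sign.s*s≡+ (opposite (χ (D′ * k′))) ⟨
    opposite (χ (D′ * k′)) Sign.* opposite (χ (D′ * k′))  ≡⟨ cong (λ s → opposite (χ (D′ * k′)) Sign.* opposite s) same-χ ⟩
    opposite (χ (D′ * k′)) Sign.* opposite (χ (D * k))    ≡⟨ Sign.*-identityʳ _ ⟨
    opposite (χ (D′ * k′)) Sign.* opposite (χ (D * k)) Sign.* Sign.+
      ≡⟨ cong₂ (λ p q → p Sign.* q) (cong₂ Sign._*_ (ν-on-u k≢0 i ui≡0) (ν-on-u′ k≢0 j uj≢0 u′j≡0)) (ε-zero u v i j (Q-zeroˡ u v {i} j ui≡0)) ⟨
    ν i Sign.* ν j Sign.* ε u v i j                      ∎
    where
    product≡ : (D′ * k′) * (D * k) ≡ ((D * D′) * (k * k)) * - 1#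
    product≡ = trans (cong (λ z → (D′ * z) * (D * k)) (det-antisym u u′))
      (solve 3 (λ D D′ k → (D′ :* (:- k)) :* (D :* k) := ((D :* D′) :* (k :* k)) :* (:- :1)) refl D D′ k)
    same-χ : χ (D′ * k′) ≡ χ (D * k)
    same-χ = χ-ratio _ _ (*-≢0 u′v′-basis (k≢0⇒k′≢0 k≢0)) (*-≢0 uv-basis k≢0)
      (subst InC (sym product≡) (residue-* (residue-*-square (D * D′) k k≢0 DD′∈C) -1-residue))

  switches-sym : ∀ i j → Switches j i → Switches i j
  switches-sym i j s = trans (sym (ε-sym u′ v′ i j)) (trans s (cong₂ Sign._*_ (Sign.*-comm (ν j) (ν i)) (ε-sym u v i j)))

  switches : ∀ i j → Switches i j
  switches i j = by-k (k ≟ 0#)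
    where
    by-position : k ≢ 0# → det (vec i) (vec j) ≢ 0# → Position (vec i) → Position (vec j) → Switches i j
    by-position k≢0 ij≢0 (on-u ui≡0) (on-u uj≡0) = ⊥-elim (ij≢0 (det≡0-trans u u≢0 i j ui≡0 uj≡0))
    by-position k≢0 ij≢0 (on-u ui≡0) (on-u′ uj≢0 u′j≡0) = switches-u-u′ k≢0 i j ui≡0 uj≢0 u′j≡0
    by-position k≢0 ij≢0 (on-u ui≡0) (off uj≢0 u′j≢0) = switches-u-off k≢0 i j ui≡0 uj≢0 u′j≢0
    by-position k≢0 ij≢0 (on-u′ ui≢0 u′i≡0) (on-u uj≡0) = switches-sym i j (switches-u-u′ k≢0 j i uj≡0 ui≢0 u′i≡0)
    by-position k≢0 ij≢0 (on-u′ _ u′i≡0) (on-u′ _ u′j≡0) = ⊥-elim (ij≢0 (det≡0-trans u′ u′≢0 i j u′i≡0 u′j≡0))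
    by-position k≢0 ij≢0 (on-u′ ui≢0 u′i≡0) (off uj≢0 u′j≢0) = switches-u′-off k≢0 i j ui≢0 u′i≡0 uj≢0 u′j≢0
    by-position k≢0 ij≢0 (off ui≢0 u′i≢0) (on-u uj≡0) = switches-sym i j (switches-u-off k≢0 j i uj≡0 ui≢0 u′i≢0)
    by-position k≢0 ij≢0 (off ui≢0 u′i≢0) (on-u′ uj≢0 u′j≡0) = switches-sym i j (switches-u′-off k≢0 j i uj≢0 u′j≡0 ui≢0 u′i≢0)
    by-position k≢0 ij≢0 (off ui≢0 u′i≢0) (off uj≢0 u′j≢0) = switches-off-off k≢0 i j ij≢0 ui≢0 u′i≢0 uj≢0 u′j≢0
    by-det : k ≢ 0# → Dec (det (vec i) (vec j) ≡ 0#) → Switches i j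
    by-det k≢0 (yes ij≡0) = switches-≈ i j ij≡0
    by-det k≢0 (no ij≢0) = by-position k≢0 ij≢0 (position (vec i)) (position (vec j))
    by-k : Dec (k ≡ 0#) → Switches i j
    by-k (yes k≡0) = switches-k≡0 k≡0 i j
    by-k (no k≢0) = by-det k≢0 (det (vec i) (vec j) ≟ 0#)

  localization : ∀ p → LineOf u′ p → IsLocalization (Γ u v) p (Γ u′ v′)
  localization p p∈⟨u′⟩ = (ν , ν-resp-≈ , switch) , isolated
    where
    switch : ∀ i j σ → Eps (Γ u v) i j σ → Eps (Γ u′ v′) i j (ν i Sign.* ν j Sign.* σ)
    switch i j σ ε≡σ = subst (Eps (Γ u′ v′) i j) (trans (switches i j) (cong (ν i Sign.* ν j Sign.*_) (sym (Eps-Γ⇒ε u v uv-basis i j σ ε≡σ))))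
      (Eps-Γ-ε u′ v′ u′v′-basis i j)
    u′p≡0 : det u′ (vec p) ≡ 0#
    u′p≡0 = LineOf⇒det≡0 {u′} {p} p∈⟨u′⟩
    isolated : Isolated (Γ u′ v′) p
    isolated y = (λ g → proj₁ (AffineChart.Γ⇒Q∈C K u′ v′ u′v′-basis p y g) (Q-zeroˡ u′ v′ {p} y u′p≡0)) ,
                 (λ g → proj₁ (AffineChart.Γ⇒Q∈C K u′ v′ u′v′-basis y p g) (Q-zeroʳ u′ v′ y {p} u′p≡0))

module GraphEquality {q : ℕ} (K : FiniteField q) where
  open FieldDefs K

  ≡G-refl : ∀ {G} → G ≡G G
  ≡G-refl x y = (λ h → h) , (λ h → h)

  ≡G-sym : ∀ {G H} → G ≡G H → H ≡G G
  ≡G-sym G≡H x y = proj₂ (G≡H x y) , proj₁ (G≡H x y)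

  ≡G-trans : ∀ {G H L} → G ≡G H → H ≡G L → G ≡G L
  ≡G-trans G≡H H≡L x y = (λ g → proj₁ (H≡L x y) (proj₁ (G≡H x y) g)) , (λ l → proj₂ (G≡H x y) (proj₂ (H≡L x y) l))

  ≡⇒≡G : ∀ {G H} → G ≡ H → G ≡G H
  ≡⇒≡G refl = ≡G-refl

  Eps-functional : ∀ H i j {σ σ′} → Eps H i j σ → Eps H i j σ′ → σ ≡ σ′
  Eps-functional H i j (inj₁ (refl , _)) (inj₁ (refl , _)) = refl
  Eps-functional H i j (inj₁ (_ , adj)) (inj₂ (_ , ¬adj)) = ⊥-elim (¬adj adj)
  Eps-functional H i j (inj₂ (_ , ¬adj)) (inj₁ (_ , adj)) = ⊥-elim (¬adj adj)
  Eps-functional H i j (inj₂ (refl , _)) (inj₂ (refl , _)) = refl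

  Eps-resp-≡G : ∀ {H H′} → H ≡G H′ → ∀ i j σ → Eps H i j σ → Eps H′ i j σ
  Eps-resp-≡G H≡H′ i j σ (inj₁ (σ≡- , (i≉j , h))) = inj₁ (σ≡- , (i≉j , proj₁ (H≡H′ i j) h))
  Eps-resp-≡G H≡H′ i j σ (inj₂ (σ≡+ , ¬adj)) = inj₂ (σ≡+ , λ (i≉j , h′) → ¬adj (i≉j , proj₂ (H≡H′ i j) h′))

  Eps-minus⇒adjacent : ∀ H i j → Eps H i j Sign.- → H i j
  Eps-minus⇒adjacent H i j (inj₁ (_ , (_ , h))) = h

  IsLocalization-resp-≡G : ∀ {G p H H′} → IsLocalization G p H → H ≡G H′ → IsLocalization G p H′
  IsLocalization-resp-≡G {p = p} ((ν , ν-resp , switch) , isolated) H≡H′ =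
    (ν , ν-resp , (λ i j σ e → Eps-resp-≡G H≡H′ i j _ (switch i j σ e))) ,
    (λ y → (λ h → proj₁ (isolated y) (proj₂ (H≡H′ p y) h)) , (λ h → proj₂ (isolated y) (proj₂ (H≡H′ y p) h)))

  -- Isolating p forces ν i = ν p ε_{p,i}, so ν is unique up to a global sign and ν i ν j is determined.
  localization-unique : ∀ G (ε : Point → Point → Sign) → (∀ i j → Eps G i j (ε i j)) →
    ∀ p H H′ → IsLocalization G p H → IsLocalization G p H′ →
    (∀ i j → H i j → ¬ i ≈ j) → (∀ i j → H′ i j → ¬ i ≈ j) → H ≡G H′
  localization-unique G ε Eps-ε p H H′ ((ν , _ , switch) , isolated) ((ν′ , _ , switch′) , isolated′) irr irr′ i j =
    transfer H H′ ν ν′ switch switch′ irr νν≡ν′ν′ , transfer H′ H ν′ ν switch′ switch irr′ (sym νν≡ν′ν′)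
    where
    forced : ∀ (L : Graph) (ν : Point → Sign) → (∀ i j σ → Eps G i j σ → Eps L i j (ν i Sign.* ν j Sign.* σ)) →
             Isolated L p → ∀ i → ν i ≡ ν p Sign.* ε p i
    forced L ν switch isolated i = solve-for-ν (ν p) (ν i) (ε p i)
      (Eps-functional L p i (switch p i (ε p i) (Eps-ε p i)) (inj₂ (refl , λ (_ , h) → proj₁ (isolated i) h)))
      where solve-for-ν : ∀ a b c → a Sign.* b Sign.* c ≡ Sign.+ → b ≡ a Sign.* c
            solve-for-ν Sign.+ Sign.+ Sign.+ _ = refl
            solve-for-ν Sign.+ Sign.- Sign.- _ = refl
            solve-for-ν Sign.- Sign.+ Sign.- _ = refl
            solve-for-ν Sign.- Sign.- Sign.+ _ = refl
    square-out : ∀ a c d → (a Sign.* c) Sign.* (a Sign.* d) ≡ c Sign.* d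
    square-out Sign.+ c d = refl
    square-out Sign.- Sign.+ Sign.+ = refl
    square-out Sign.- Sign.+ Sign.- = refl
    square-out Sign.- Sign.- Sign.+ = refl
    square-out Sign.- Sign.- Sign.- = refl
    νν≡ν′ν′ : ν i Sign.* ν j ≡ ν′ i Sign.* ν′ j
    νν≡ν′ν′ = trans (cong₂ Sign._*_ (forced H ν switch isolated i) (forced H ν switch isolated j))
               (trans (square-out (ν p) (ε p i) (ε p j))
                 (sym (trans (cong₂ Sign._*_ (forced H′ ν′ switch′ isolated′ i) (forced H′ ν′ switch′ isolated′ j))
                             (square-out (ν′ p) (ε p i) (ε p j)))))
    transfer : ∀ L L′ (λ₁ λ₂ : Point → Sign) →
               (∀ i j σ → Eps G i j σ → Eps L i j (λ₁ i Sign.* λ₁ j Sign.* σ)) →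
               (∀ i j σ → Eps G i j σ → Eps L′ i j (λ₂ i Sign.* λ₂ j Sign.* σ)) →
               (∀ i j → L i j → ¬ i ≈ j) → λ₁ i Sign.* λ₁ j ≡ λ₂ i Sign.* λ₂ j → L i j → L′ i j
    transfer L L′ λ₁ λ₂ switch₁ switch₂ irrL same h = Eps-minus⇒adjacent L′ i j
      (subst (Eps L′ i j) (trans (cong (Sign._* ε i j) (sym same)) minus) (switch₂ i j (ε i j) (Eps-ε i j)))
      where
      minus : λ₁ i Sign.* λ₁ j Sign.* ε i j ≡ Sign.-
      minus = Eps-functional L i j (switch₁ i j (ε i j) (Eps-ε i j)) (inj₁ (refl , (irrL i j h , h)))

module Orbits (t : ℕ) (K : FiniteField (4 ℕ.* t ℕ.+ 5)) where
  open FieldDefs K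
  open FieldBasics K
  open QuadraticResidues t K
  open ProjectiveLine K
  open Signs t K
  open GraphEquality K
  open ≡-Reasoning

  square-residue : ∀ a → a ≢ 0# → InC (a * a)
  square-residue a a≢0 = *-≢0 a≢0 a≢0 , (a , refl)

  localization-of-Γ : ∀ u v → Basis u v → ∀ u′ v′ → Basis u′ v′ → InC (det u v * det u′ v′) →
                      ∀ p → LineOf u′ p → IsLocalization (Γ u v) p (Γ u′ v′)
  localization-of-Γ u v uv-basis u′ v′ u′v′-basis DD′∈C = Switch.localization t K u v uv-basis u′ v′ u′v′-basis DD′∈C

  localization-unique-Γ : ∀ u v → Basis u v → ∀ p H H′ → IsLocalization (Γ u v) p H → IsLocalization (Γ u v) p H′ →
    (∀ i j → H i j → ¬ i ≈ j) → (∀ i j → H′ i j → ¬ i ≈ j) → H ≡G H′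
  localization-unique-Γ u v uv-basis = localization-unique (Γ u v) (ε u v) (Eps-Γ-ε u v uv-basis)

  -- Both graphs are the localization of Γ u v at ⟨u⟩.
  Γ-≡G-same-u : ∀ u v v′ → Basis u v → (uv′-basis : Basis u v′) → InC (det u v * det u v′) → Γ u v ≡G Γ u v′
  Γ-≡G-same-u u v v′ uv-basis uv′-basis DD′∈C = localization-unique-Γ u v uv-basis ⟨u⟩ (Γ u v) (Γ u v′)
    (localization-of-Γ u v uv-basis u v uv-basis (square-residue (det u v) uv-basis) ⟨u⟩ (LineOf-self u u≢0))
    (localization-of-Γ u v uv-basis u v′ uv′-basis DD′∈C ⟨u⟩ (LineOf-self u u≢0))
    (AffineChart.Γ-irreflexive K u v uv-basis) (AffineChart.Γ-irreflexive K u v′ uv′-basis)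
    where
    u≢0 = det≢0⇒≢0ˡ u v uv-basis
    ⟨u⟩ = (u , u≢0)

  Γ-≡G⇒residue : ∀ u v u′ v′ → (uv-basis : Basis u v) → (u′v′-basis : Basis u′ v′) →
                 Γ u v ≡G Γ u′ v′ → InC (det u v * det u′ v′)
  Γ-≡G⇒residue u v u′ v′ uv-basis u′v′-basis Γ≡Γ′ = by-cases (det u u′ ≟ 0#)
    where
    module C = AffineChart K u v uv-basis
    module C′ = AffineChart K u′ v′ u′v′-basis
    u′≢0 = det≢0⇒≢0ˡ u′ v′ u′v′-basis
    D = det u v
    D′ = det u′ v′
    by-cases : Dec (det u u′ ≡ 0#) → InC (D * D′)
    -- Otherwise the point ⟨u′⟩, isolated in Γ u′ v′, would have a neighbour in Γ u v.
    by-cases (no uu′≢0) = ⊥-elim (proj₁ (C′.Γ⇒Q∈C p z (proj₁ (Γ≡Γ′ p z) p~z)) (Q-zeroˡ u′ v′ {p} z (det-self u′)))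
      where
      p = (u′ , u′≢0)
      α = C.coord p
      z = C.point (α - 1#)
      α-[α-1]≡1 : α - C.coord z ≡ 1#
      α-[α-1]≡1 = trans (cong (λ w → α - w) (C.coord-point (α - 1#))) (solve 1 (λ a → a :- (a :- :1) := :1) refl α)
      p~z : Γ u v p z
      p~z = C.coords⇒Γ p z uu′≢0 (C.det-u-point≢0 (α - 1#)) (subst InC (sym α-[α-1]≡1) (isResidue⇒ isResidue-1))
    by-cases (yes uu′≡0) = residue-/-square (D * D′) T T≢0
      (subst InC product (residue-* (C.Γ⇒Q∈C x y x~y) (C′.Γ⇒Q∈C x y (proj₁ (Γ≡Γ′ x y) x~y))))
      where
      u′∥u = det≡0⇒parallel u u′ C.u≢0 u′≢0 uu′≡0
      κ = proj₁ u′∥u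
      x = C.point 0#
      y = C.point (- 1#)
      0-[-1]≡1 : C.coord x - C.coord y ≡ 1#
      0-[-1]≡1 = trans (cong₂ _-_ (C.coord-point 0#) (C.coord-point (- 1#))) (solve 0 (:0 :- (:- :1) := :1) refl)
      x~y : Γ u v x y
      x~y = C.coords⇒Γ x y (C.det-u-point≢0 0#) (C.det-u-point≢0 (- 1#)) (subst InC (sym 0-[-1]≡1) (isResidue⇒ isResidue-1))
      e = det (vec x) (vec y)
      a = det u (vec x)
      b = det u (vec y)
      T = κ * e * a * b
      nonzero = Q≢0⇒ u v x y (proj₁ (C.Γ⇒Q∈C x y x~y))
      T≢0 : T ≢ 0#
      T≢0 = *-≢0 (*-≢0 (*-≢0 (proj₁ (proj₂ u′∥u)) (proj₁ nonzero)) (proj₁ (proj₂ nonzero))) (proj₂ (proj₂ nonzero))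
      product : Q u v x y * Q u′ v′ x y ≡ (D * D′) * (T * T)
      product = trans (cong₂ (λ p q → Q u v x y * (D′ * e * p * q))
                        (trans (cong (λ w → det w (vec x)) (proj₂ (proj₂ u′∥u))) (det-·ˡ κ u (vec x)))
                        (trans (cong (λ w → det w (vec y)) (proj₂ (proj₂ u′∥u))) (det-·ˡ κ u (vec y))))
        (solve 6 (λ D D′ e k a b → (D :* e :* a :* b) :* (D′ :* e :* (k :* a) :* (k :* b)) := (D :* D′) :* ((k :* e :* a :* b) :* (k :* e :* a :* b))) refl D D′ e κ a b)

  localization-at-v : ∀ u v → Basis u v → ∀ x → LineOf v x → IsLocalization (Γ u v) x (Γ v u)
  localization-at-v u v uv-basis = localization-of-Γ u v uv-basis v u (det-swap-≢0 u v uv-basis)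
    (subst InC D·D*-1≡D·det-v-u (residue-* (square-residue D uv-basis) -1-residue))
    where
    D = det u v
    D·D*-1≡D·det-v-u : D * D * - 1# ≡ D * det v u
    D·D*-1≡D·det-v-u = sym (trans (cong (D *_) (det-antisym u v)) (solve 1 (λ D → D :* (:- D) := D :* D :* (:- :1)) refl D))

  det-image : ∀ φ → detM φ ≡ 1# → ∀ u v → det (app φ u) (app φ v) ≡ det u v
  det-image φ detφ≡1 u v = trans (det-app φ u v) (trans (cong (_* det u v) detφ≡1) (*-identityˡ _))

  same-orbit⇒residue : ∀ u v u′ v′ → Basis u v → Basis u′ v′ → SameOrbit (Γ u v) (Γ u′ v′) → InC (det u v * det u′ v′)
  same-orbit⇒residue u v u′ v′ uv-basis u′v′-basis (φ , detφ≡1 , Γ′≡Img) =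
    subst (λ d → InC (d * det u′ v′)) (det-image φ detφ≡1 u v)
      (Γ-≡G⇒residue (app φ u) (app φ v) u′ v′ φuv-basis u′v′-basis
        (≡G-sym (≡G-trans Γ′≡Img (AffineChart.Img-Γ K u v uv-basis φ))))
    where
    φuv-basis : Basis (app φ u) (app φ v)
    φuv-basis e = uv-basis (trans (sym (det-image φ detφ≡1 u v)) e)

  residue⇒same-orbit : ∀ u v u′ v′ → Basis u v → Basis u′ v′ → InC (det u v * det u′ v′) → SameOrbit (Γ u v) (Γ u′ v′)
  residue⇒same-orbit u v u′ v′ uv-basis u′v′-basis DD′∈C = φ , detφ≡1 ,
    ≡G-trans (≡G-sym (Γ-≡G-same-u u′ w v′ u′w-basis u′v′-basis (subst (λ d → InC (d * D′)) (sym det-u′-w) DD′∈C)))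
      (≡G-trans (≡⇒≡G (cong₂ Γ (sym (transfer-u u v u′ w uv-basis)) (sym (transfer-v u v u′ w uv-basis))))
        (≡G-sym (AffineChart.Img-Γ K u v uv-basis φ)))
    where
    D = det u v
    D′ = det u′ v′
    w = (D * inv D′) · v′
    φ = transfer u v u′ w
    det-u′-w : det u′ w ≡ D
    det-u′-w = trans (det-·ʳ (D * inv D′) u′ v′)
      (trans (*-assoc D (inv D′) D′) (trans (cong (D *_) (*-inverseˡ D′ u′v′-basis)) (*-identityʳ D)))
    u′w-basis : Basis u′ w
    u′w-basis e = uv-basis (trans (sym det-u′-w) e)
    detφ≡1 : detM φ ≡ 1#
    detφ≡1 = trans (detM-transfer u v u′ w uv-basis) (trans (cong (inv D *_) det-u′-w) (*-inverseˡ D uv-basis))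

  two-orbits : Σ V λ u₁ → Σ V λ v₁ → Σ V λ u₂ → Σ V λ v₂ →
       Basis u₁ v₁ × Basis u₂ v₂
     × ¬ SameOrbit (Γ u₁ v₁) (Γ u₂ v₂)
     × (∀ u′ v′ → Basis u′ v′ → SameOrbit (Γ u₁ v₁) (Γ u′ v′) ⊎ SameOrbit (Γ u₂ v₂) (Γ u′ v′))
  two-orbits = e₁ , e₂ , e₁ , (0# , n) , e₁e₂-basis , e₁n-basis , different , every
    where
    e₁ e₂ : V
    e₁ = 1# , 0#
    e₂ = 0# , 1#
    n-nonresidue = #≢0⇒ isNonResidue (t ℕ.+ (suc t ℕ.+ 0)) #nonresidues
    n = proj₁ n-nonresidue
    n∈N = proj₂ n-nonresidue
    det-e₁ : ∀ m → det e₁ (0# , m) ≡ m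
    det-e₁ m = solve 1 (λ m → :1 :* m :- :0 :* :0 := m) refl m
    e₁e₂-basis : Basis e₁ e₂
    e₁e₂-basis e = 1≢0 (trans (sym (det-e₁ 1#)) e)
    e₁n-basis : Basis e₁ (0# , n)
    e₁n-basis e = proj₁ (isNonResidue⇒ n∈N) (trans (sym (det-e₁ n)) e)
    different : ¬ SameOrbit (Γ e₁ e₂) (Γ e₁ (0# , n))
    different same = true≢false (trans (sym (⇒isResidue n∈C)) (nonresidue⇒¬residue n∈N))
      where
      n∈C : InC n
      n∈C = subst InC (trans (cong₂ _*_ (det-e₁ 1#) (det-e₁ n)) (*-identityˡ n))
              (same-orbit⇒residue e₁ e₂ e₁ (0# , n) e₁e₂-basis e₁n-basis same)
    every : ∀ u′ v′ → Basis u′ v′ → SameOrbit (Γ e₁ e₂) (Γ u′ v′) ⊎ SameOrbit (Γ e₁ (0# , n)) (Γ u′ v′)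
    every u′ v′ u′v′-basis = by-class (trichotomy (det u′ v′))
      where
      by-class : Trichotomy (det u′ v′) → SameOrbit (Γ e₁ e₂) (Γ u′ v′) ⊎ SameOrbit (Γ e₁ (0# , n)) (Γ u′ v′)
      by-class (zero D′≡0) = ⊥-elim (u′v′-basis D′≡0)
      by-class (residue D′∈C _) = inj₁ (residue⇒same-orbit e₁ e₂ u′ v′ e₁e₂-basis u′v′-basis
        (subst InC (sym (trans (cong (_* det u′ v′) (det-e₁ 1#)) (*-identityˡ _))) (isResidue⇒ D′∈C)))
      by-class (nonresidue _ D′∈N) = inj₂ (residue⇒same-orbit e₁ (0# , n) u′ v′ e₁n-basis u′v′-basis
        (subst InC (sym (cong (_* det u′ v′) (det-e₁ n))) (nonresidue-*-nonresidue n∈N D′∈N)))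

  orbit⇔localization : ∀ u′ v′ → Basis u′ v′ → (H : Graph) → IsGraph H →
      (SameOrbit (Γ u′ v′) H → Σ Point λ x → IsLocalization (Γ u′ v′) x H)
    × ((Σ Point λ x → IsLocalization (Γ u′ v′) x H) → SameOrbit (Γ u′ v′) H)
  orbit⇔localization u′ v′ u′v′-basis H (_ , H-irreflexive , H-resp-≈) = forth , back
    where
    D′ = det u′ v′
    D′²∈C : ∀ {d} → d ≡ D′ → InC (D′ * d)
    D′²∈C refl = square-residue D′ u′v′-basis
    H-irreflexive′ : ∀ i j → H i j → ¬ i ≈ j
    H-irreflexive′ i j h i≈j = H-irreflexive i (H-resp-≈ i i j i (≈-refl i) (≈-sym i j i≈j) h)
    forth : SameOrbit (Γ u′ v′) H → Σ Point λ x → IsLocalization (Γ u′ v′) x H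
    forth (φ , detφ≡1 , H≡Img) = p , IsLocalization-resp-≡G
        (localization-of-Γ u′ v′ u′v′-basis (app φ u′) (app φ v′) φ-basis (D′²∈C (det-image φ detφ≡1 u′ v′)) p (LineOf-self (app φ u′) (proj₂ p)))
        (≡G-sym (≡G-trans H≡Img (AffineChart.Img-Γ K u′ v′ u′v′-basis φ)))
      where
      φ-basis : Basis (app φ u′) (app φ v′)
      φ-basis e = u′v′-basis (trans (sym (det-image φ detφ≡1 u′ v′)) e)
      p : Point
      p = app φ u′ , det≢0⇒≢0ˡ _ _ φ-basis
    back : (Σ Point λ x → IsLocalization (Γ u′ v′) x H) → SameOrbit (Γ u′ v′) H
    back (p , H-localization) =
      let (φ , detφ≡1 , Γp≡Img) = residue⇒same-orbit u′ v′ (vec p) w u′v′-basis pw-basis (D′²∈C det-p-w)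
      in φ , detφ≡1 , ≡G-trans H≡Γp Γp≡Img
      where
      w-complement = complement (vec p) (proj₂ p) D′
      w = proj₁ w-complement
      det-p-w = proj₂ w-complement
      pw-basis : Basis (vec p) w
      pw-basis e = u′v′-basis (trans (sym det-p-w) e)
      H≡Γp : H ≡G Γ (vec p) w
      H≡Γp = localization-unique-Γ u′ v′ u′v′-basis p H (Γ (vec p) w) H-localization
        (localization-of-Γ u′ v′ u′v′-basis (vec p) w pw-basis (D′²∈C det-p-w) p (LineOf-self (vec p) (proj₂ p)))
        H-irreflexive′ (AffineChart.Γ-irreflexive K (vec p) w pw-basis)

mainTheorem14 : (t : ℕ) → IsPrimePower (4 ℕ.* t ℕ.+ 5) → (K : FiniteField (4 ℕ.* t ℕ.+ 5)) →
    let open FieldDefs K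
        s = suc t
    in
    ((u v : V) → Basis u v →
      (Diameter (Γ u v) (Xu u) 2
        × (∀ x → Xu u x → HasSize (λ z → Γ u v x z) (2 ℕ.* s))
        × (∀ x y → Xu u x → Xu u y → Γ u v x y →
             HasSize (λ z → Γ u v x z × Γ u v y z) t)
        × (∀ x y → Xu u x → Xu u y → Dist (Γ u v) x y 2 →
             HasSize (λ z → Γ u v x z × Γ u v y z) s))
      × (∀ x → LineOf v x → IsLocalization (Γ u v) x (Γ v u))
      × (∀ φ → detM φ ≢ 0# → Img φ (Γ u v) ≡G Γ (app φ u) (app φ v))
      × (∀ φ → detM φ ≢ 0# → Stabilizes φ u →
           (IsSquare (detM φ) → Γ (app φ u) (app φ v) ≡G Γ u v)
         × (¬ IsSquare (detM φ) → Γ (app φ u) (app φ v) ≡G Complement (Xu u) (Γ u v))))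
    × (Σ V λ u₁ → Σ V λ v₁ → Σ V λ u₂ → Σ V λ v₂ →
         Basis u₁ v₁ × Basis u₂ v₂
         × ¬ SameOrbit (Γ u₁ v₁) (Γ u₂ v₂)
         × (∀ u′ v′ → Basis u′ v′ →
              SameOrbit (Γ u₁ v₁) (Γ u′ v′) ⊎ SameOrbit (Γ u₂ v₂) (Γ u′ v′)))
    × (∀ u′ v′ → Basis u′ v′ → (H : Graph) → IsGraph H →
         (SameOrbit (Γ u′ v′) H → Σ Point λ x → IsLocalization (Γ u′ v′) x H)
         × ((Σ Point λ x → IsLocalization (Γ u′ v′) x H) → SameOrbit (Γ u′ v′) H))
mainTheorem14 t _ K =
  (λ u v uv-basis →
      PaleyGraph.strongly-regular t K u v uv-basis
    , localization-at-v u v uv-basis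
    , (λ φ _ → AffineChart.Img-Γ K u v uv-basis φ)
    , Stabilizer.Γ-stabilizer t K u v uv-basis)
  , two-orbits
  , orbit⇔localization
  where open Orbits t K
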